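{- Let $\varepsilon>0$ and $C>0$. There are constants $c_1,c_2>0$ such that for all sufficiently large $n$ and all integers $k$ with $2\le k\le Cn^{1/2-\varepsilon}$, there exists a sequence $S\in[n]^m$ (for some length $m$) with $\mathit{WS}(S)\le c_1\,m\log k$ and $LF^k(S)\ge c_2\,m\log(n/k)$.
   Context: Logarithms are base 2. For $S=(s_1,\dots,s_m)$: $\rho_S(j)=\max\{i<j:s_i=s_j\}$ or $0$ if none; $w_S(j)=\{s_i:\rho_S(j)<i\le j\}$; $\mathit{WS}(S)=\sum_{j=1}^m\log|w_S(j)|$. For a BST $T$ on $[n]$ with $d_T(x,y)$ the $x$–$y$ path length, a finger strategy $(\vec f\in[k]^m,\vec\ell\in[n]^k)$ starts finger $i$ at $\ell_i$ and at time $t$ moves finger $f_t$ from its location $\sigma(f_t,t)$ to $s_t$, costing $\sum_t(1+d_T(s_t,\sigma(f_t,t)))$; $LF^k(S)$ is the minimum cost over all BSTs $T$ on $[n]$ and strategies.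
   Formalization: The parameters ε and C range only over the positive rationals, and the constants $c_1,c_2$ are taken in the positive rationals. -}

module Defs where

open import Data.Nat using (ℕ; zero; suc; _+_; _*_; _∸_; _^_; _≤_; _≡ᵇ_; _<ᵇ_)
open import Data.Nat.Properties using (_≟_)
open import Data.Bool using (Bool; true; false; if_then_else_)
open import Data.List using (List; []; _∷_; length; _++_; map; upTo; takeWhile; deduplicate)
open import Data.List.Relation.Unary.All as LAll using ()
open import Data.Nat.ListAction using (product)
open import Data.Vec using (Vec; lookup; _[_]≔_)
open import Data.Vec.Relation.Unary.All as VAll using ()
open import Data.Fin using (Fin)
open import Data.Product using (_×_)
open import Relation.Nullary.Decidable using (¬?)
open import Relation.Binary.PropositionalEquality using (_≡_)

InRange : ℕ → ℕ → Set
InRange n x = 1 ≤ x × x ≤ n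

distinctCount : List ℕ → ℕ
distinctCount xs = length (deduplicate _≟_ xs)

-- wsizes rp rest : rp is the reversed prefix s_{j-1},…,s_1 already read;
-- for the next element x = s_j, w_S(j) consists of s_j together with the
-- elements s_i, ρ_S(j) < i < j, i.e. the longest initial segment of rp
-- not containing x.
wsizes : List ℕ → List ℕ → List ℕ
wsizes rp [] = []
wsizes rp (x ∷ xs) =
  distinctCount (x ∷ takeWhile (λ y → ¬? (y ≟ x)) rp) ∷ wsizes (x ∷ rp) xs

wsetSizes : List ℕ → List ℕ
wsetSizes S = wsizes [] S

-- 2^{WS(S)} = ∏_{j=1}^m |w_S(j)|
expWS : List ℕ → ℕ
expWS S = product (wsetSizes S)

data Tree : Set where
  leaf : Tree
  node : Tree → ℕ → Tree → Tree

inorder : Tree → List ℕ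
inorder leaf = []
inorder (node l x r) = inorder l ++ (x ∷ inorder r)

IsBSTOn : ℕ → Tree → Set
IsBSTOn n T = inorder T ≡ map suc (upTo n)

-- root-to-node path of key x (false = left, true = right)
path : Tree → ℕ → List Bool
path leaf x = []
path (node l y r) x =
  if x ≡ᵇ y then [] else (if x <ᵇ y then false ∷ path l x else true ∷ path r x)

lcp : List Bool → List Bool → ℕ
lcp (false ∷ p) (false ∷ q) = suc (lcp p q)
lcp (true ∷ p) (true ∷ q) = suc (lcp p q)
lcp _ _ = 0

-- d_T(x,y): number of edges on the x–y path in T
dist : Tree → ℕ → ℕ → ℕ
dist T x y = (length (path T x) + length (path T y)) ∸ (2 * lcp (path T x) (path T y))

-- Cost of a finger strategy: loc = current finger locations,
-- S = remaining requests, fs = remaining finger choices.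
fingerCost : Tree → {k : ℕ} → Vec ℕ k → List ℕ → List (Fin k) → ℕ
fingerCost T loc (s ∷ ss) (f ∷ fs) =
  suc (dist T s (lookup loc f)) + fingerCost T (loc [ f ]≔ s) ss fs
fingerCost T loc _ _ = 0

-- "LF^k(S) ≥ c2 m log(n/k)" with c2 = a/b, exponentiated:
-- for every BST T on [n] and every finger strategy (f, ℓ),
-- n^{a m} ≤ 2^{b · cost} · k^{a m}.
LFLowerBound : (n k : ℕ) → List ℕ → (a b : ℕ) → Set
LFLowerBound n k S a b =
  (T : Tree) → IsBSTOn n T →
  (ℓ : Vec ℕ k) → VAll.All (InRange n) ℓ →
  (fs : List (Fin k)) → length fs ≡ length S →
  n ^ (a * length S) ≤ 2 ^ (b * fingerCost T ℓ S fs) * k ^ (a * length S)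

module Submission where

-- For k fingers we build a sequence of rounds: a round is an arithmetic progression of 2k
-- keys, and every round (one for each start s and gap g + 1) is repeated R times.  The
-- repetitions keep every working set of size ≤ 4k + 1, so WS(S) = O(m log k).  For the
-- lower bound fix a BST T on [n] and a scale d.  Within a round, at most k requests are
-- first uses of a finger; every other request either moves a finger farther than d or is
-- within distance d of an earlier request of the round (a close pair).  Since a BST has
-- at most 2^(d+2) keys within distance d of any key, and the progressions through a key x
-- with different gaps meet distinct keys, close pairs are rare once 2^d·64k ≤ n/4k; then
-- every strategy pays (d+1)/4 per request, with 2^d ≈ n/k², which is Ω(log(n/k)) in the
-- regime k ≤ C n^(1/2−ε).

open import Defs
open import Data.Nat
open import Data.Nat.Properties
open import Data.Nat.DivMod
open import Data.Nat.ListAction using (product)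
open import Data.Nat.ListAction.Properties using (product-++)
open import Data.Nat.Solver using (module +-*-Solver)
open import Data.Bool using (Bool; true; false; not; T)
import Data.Bool.Properties as Bool
open import Data.Fin as Fin using (Fin)
open import Data.Vec using (Vec; lookup; _[_]≔_)
open import Data.Vec.Properties using (lookup∘update; lookup∘update′)
open import Data.List using (List; []; _∷_; length; _++_; [_]; map; take; drop; concat; replicate; allFin; takeWhile; _ʳ++_)
open import Data.List.Properties using (length-++; length-map; map-upTo; ≡-dec; length-take; length-drop; length-tabulate; length-replicate; length-deduplicate; concat-++; length-ʳ++; ʳ++-defn; ++-assoc; ++-identityʳ)
open import Data.List.Membership.Propositional using (_∈_)
open import Data.List.Membership.Propositional.Properties using (∈-++⁺ˡ; ∈-++⁺ʳ; ∈-++⁻; ∈-map⁺; ∈-map⁻; ∈-upTo⁺; ∈-allFin)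
open import Data.List.Relation.Unary.Any using (here; there)
open import Data.List.Relation.Unary.Any.Properties using (reverseAcc⁺)
open import Data.List.Relation.Unary.All as All using (All; []; _∷_)
import Data.List.Relation.Unary.All.Properties as All
open import Data.List.Relation.Unary.AllPairs using (AllPairs; []; _∷_)
import Data.List.Relation.Unary.AllPairs.Properties as AllPairs
open import Data.List.Relation.Unary.Unique.Propositional using (Unique)
open import Data.Maybe using (Maybe; just; nothing)
open import Data.Maybe.Properties using (just-injective)
open import Data.Product using (Σ; _×_; _,_; proj₁; proj₂; ∃-syntax)
open import Data.Sum using (inj₁; inj₂)
open import Data.Empty using (⊥-elim)
open import Relation.Nullary using (¬_; yes; no; contradiction)
open import Relation.Nullary.Decidable using (¬?; _×-dec_)
open import Relation.Binary.Definitions using (DecidableEquality)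
open import Relation.Binary.PropositionalEquality hiding ([_])
open +-*-Solver

sumN : ℕ → (ℕ → ℕ) → ℕ
sumN zero f = 0
sumN (suc n) f = sumN n f + f n

sumN-cong : ∀ n f g → (∀ x → f x ≡ g x) → sumN n f ≡ sumN n g
sumN-cong zero f g e = refl
sumN-cong (suc n) f g e = cong₂ _+_ (sumN-cong n f g e) (e n)

sumN-mono : ∀ n f g → (∀ x → x < n → f x ≤ g x) → sumN n f ≤ sumN n g
sumN-mono zero f g le = z≤n
sumN-mono (suc n) f g le = +-mono-≤ (sumN-mono n f g (λ x x<n → le x (m<n⇒m<1+n x<n))) (le n ≤-refl)

sumN-bound : ∀ n f c → (∀ x → x < n → f x ≤ c) → sumN n f ≤ n * c
sumN-bound zero f c le = z≤n
sumN-bound (suc n) f c le =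
  ≤-trans (+-mono-≤ (sumN-bound n f c (λ x x<n → le x (m<n⇒m<1+n x<n))) (le n ≤-refl))
          (≤-reflexive (+-comm (n * c) c))

sumN-+ : ∀ n f g → sumN n (λ x → f x + g x) ≡ sumN n f + sumN n g
sumN-+ zero f g = refl
sumN-+ (suc n) f g = begin
  sumN n (λ x → f x + g x) + (f n + g n) ≡⟨ cong (_+ (f n + g n)) (sumN-+ n f g) ⟩
  (sumN n f + sumN n g) + (f n + g n)    ≡⟨ +-assoc (sumN n f) (sumN n g) (f n + g n) ⟩
  sumN n f + (sumN n g + (f n + g n))    ≡⟨ cong (sumN n f +_) (+-comm (sumN n g) (f n + g n)) ⟩
  sumN n f + ((f n + g n) + sumN n g)    ≡⟨ cong (sumN n f +_) (+-assoc (f n) (g n) (sumN n g)) ⟩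
  sumN n f + (f n + (g n + sumN n g))    ≡⟨ sym (+-assoc (sumN n f) (f n) (g n + sumN n g)) ⟩
  (sumN n f + f n) + (g n + sumN n g)    ≡⟨ cong ((sumN n f + f n) +_) (+-comm (g n) (sumN n g)) ⟩
  (sumN n f + f n) + (sumN n g + g n)    ∎
  where open ≡-Reasoning

sumN-zero : ∀ n → sumN n (λ _ → 0) ≡ 0
sumN-zero zero = refl
sumN-zero (suc n) = cong (_+ 0) (sumN-zero n)

sumN-swap : ∀ a b (f : ℕ → ℕ → ℕ) →
            sumN a (λ x → sumN b (f x)) ≡ sumN b (λ y → sumN a (λ x → f x y))
sumN-swap zero b f = sym (sumN-zero b)
sumN-swap (suc a) b f =
  trans (cong (_+ sumN b (f a)) (sumN-swap a b f))
        (sym (sumN-+ b (λ y → sumN a (λ x → f x y)) (f a)))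

sumN-split : ∀ c a f → sumN c f + sumN a (λ s → f (c + s)) ≡ sumN (c + a) f
sumN-split c zero f = trans (+-identityʳ _) (cong (λ z → sumN z f) (sym (+-identityʳ c)))
sumN-split c (suc a) f = begin
  sumN c f + (sumN a (λ s → f (c + s)) + f (c + a)) ≡⟨ sym (+-assoc (sumN c f) _ _) ⟩
  sumN c f + sumN a (λ s → f (c + s)) + f (c + a)   ≡⟨ cong (_+ f (c + a)) (sumN-split c a f) ⟩
  sumN (c + a) f + f (c + a)                        ≡⟨ cong (λ z → sumN z f) (sym (+-suc c a)) ⟩
  sumN (c + suc a) f                                ∎
  where open ≡-Reasoning

sumN-head : ∀ t f → sumN (suc t) f ≡ f 0 + sumN t (λ u → f (suc u))
sumN-head zero f = +-comm 0 (f 0)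
sumN-head (suc t) f = trans (cong (_+ f (suc t)) (sumN-head t f)) (+-assoc (f 0) _ _)

sumN-prefix : ∀ a b f → a ≤ b → sumN a f ≤ sumN b f
sumN-prefix a b f a≤b = begin
  sumN a f                                     ≤⟨ m≤m+n (sumN a f) _ ⟩
  sumN a f + sumN (b ∸ a) (λ s → f (a + s))    ≡⟨ sumN-split a (b ∸ a) f ⟩
  sumN (a + (b ∸ a)) f                         ≡⟨ cong (λ z → sumN z f) (m+[n∸m]≡n a≤b) ⟩
  sumN b f                                     ∎
  where open ≤-Reasoning

sumN-window : ∀ c a b f → c + a ≤ b → sumN a (λ s → f (c + s)) ≤ sumN b f
sumN-window c a b f c+a≤b = begin
  sumN a (λ s → f (c + s))            ≤⟨ m≤n+m _ (sumN c f) ⟩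
  sumN c f + sumN a (λ s → f (c + s)) ≡⟨ sumN-split c a f ⟩
  sumN (c + a) f                      ≤⟨ sumN-prefix (c + a) b f c+a≤b ⟩
  sumN b f                            ∎
  where open ≤-Reasoning

module Pigeonhole {A : Set} (_≟_ : DecidableEquality A) where

  delete : A → List A → List A
  delete x [] = []
  delete x (y ∷ ys) with x ≟ y
  ... | yes _ = ys
  ... | no _ = y ∷ delete x ys

  delete-length : ∀ x ys → x ∈ ys → suc (length (delete x ys)) ≡ length ys
  delete-length x (y ∷ ys) x∈ with x ≟ y
  ... | yes _ = refl
  delete-length x (y ∷ ys) (here x≡y) | no x≢y = ⊥-elim (x≢y x≡y)
  delete-length x (y ∷ ys) (there x∈) | no _ = cong suc (delete-length x ys x∈)

  delete-keeps : ∀ x z ys → z ≢ x → z ∈ ys → z ∈ delete x ys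
  delete-keeps x z (y ∷ ys) z≢x z∈ with x ≟ y
  delete-keeps x z (y ∷ ys) z≢x (here z≡y) | yes x≡y = ⊥-elim (z≢x (trans z≡y (sym x≡y)))
  delete-keeps x z (y ∷ ys) z≢x (there z∈) | yes _ = z∈
  delete-keeps x z (y ∷ ys) z≢x (here z≡y) | no _ = here z≡y
  delete-keeps x z (y ∷ ys) z≢x (there z∈) | no _ = there (delete-keeps x z ys z≢x z∈)

  pigeonhole : ∀ xs ys → Unique xs → (∀ {z} → z ∈ xs → z ∈ ys) → length xs ≤ length ys
  pigeonhole [] ys _ _ = z≤n
  pigeonhole (x ∷ xs) ys (x∉xs ∷ u) xs⊆ys =
    subst (suc (length xs) ≤_) (delete-length x ys (xs⊆ys (here refl)))
      (s≤s (pigeonhole xs (delete x ys) u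
        (λ {z} z∈ → delete-keeps x z ys (λ z≡x → All.lookup x∉xs z∈ (sym z≡x)) (xs⊆ys (there z∈)))))

≡ᵇ-true : ∀ m n → (m ≡ᵇ n) ≡ true → m ≡ n
≡ᵇ-true m n e = ≡ᵇ⇒≡ m n (subst T (sym e) _)

≡ᵇ-false : ∀ m n → (m ≡ᵇ n) ≡ false → m ≢ n
≡ᵇ-false m n e m≡n = subst T e (≡⇒≡ᵇ m n m≡n)

<ᵇ-true : ∀ m n → (m <ᵇ n) ≡ true → m < n
<ᵇ-true m n e = <ᵇ⇒< m n (subst T (sym e) _)

<ᵇ-false : ∀ m n → (m <ᵇ n) ≡ false → ¬ (m < n)
<ᵇ-false m n e m<n = subst T e (<⇒<ᵇ m<n)

-- Searching a binary search tree: following the search path of a stored key leads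
-- back to that key, so distinct keys have distinct search paths.

Sorted : List ℕ → Set
Sorted = AllPairs _<_

sorted-++ : ∀ xs ys → Sorted (xs ++ ys) →
            Sorted xs × Sorted ys × (∀ {a b} → a ∈ xs → b ∈ ys → a < b)
sorted-++ [] ys s = [] , s , λ ()
sorted-++ (x ∷ xs) ys (x<xs++ys ∷ s) with sorted-++ xs ys s
... | sxs , sys , xs<ys = (All.++⁻ˡ xs x<xs++ys ∷ sxs) , sys , below
  where
  below : ∀ {a b} → a ∈ x ∷ xs → b ∈ ys → a < b
  below (here refl) b∈ = All.lookup (All.++⁻ʳ xs x<xs++ys) b∈
  below (there a∈) b∈ = xs<ys a∈ b∈

follow : Tree → List Bool → Maybe ℕ
follow leaf _ = nothing
follow (node l x r) [] = just x
follow (node l x r) (false ∷ p) = follow l p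
follow (node l x r) (true ∷ p) = follow r p

follow-path : ∀ T y → Sorted (inorder T) → y ∈ inorder T → follow T (path T y) ≡ just y
follow-path leaf y _ ()
follow-path (node l x r) y s y∈ with sorted-++ (inorder l) (x ∷ inorder r) s
... | sl , (x<r ∷ sr) , l<xr with y ≡ᵇ x in y=x
... | true = cong just (sym (≡ᵇ-true y x y=x))
... | false with y <ᵇ x in y<x
... | true = follow-path l y sl y∈l
  where
  y∈l : y ∈ inorder l
  y∈l with ∈-++⁻ (inorder l) y∈
  ... | inj₁ y∈l = y∈l
  ... | inj₂ (here refl) = ⊥-elim (<-irrefl refl (<ᵇ-true y x y<x))
  ... | inj₂ (there y∈r) = ⊥-elim (<-asym (<ᵇ-true y x y<x) (All.lookup x<r y∈r))
... | false = follow-path r y sr y∈r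
  where
  y∈r : y ∈ inorder r
  y∈r with ∈-++⁻ (inorder l) y∈
  ... | inj₁ y∈l = ⊥-elim (<ᵇ-false y x y<x (l<xr y∈l (here refl)))
  ... | inj₂ (here refl) = ⊥-elim (≡ᵇ-false y x y=x refl)
  ... | inj₂ (there y∈r) = y∈r

path-injective : ∀ T y y′ → Sorted (inorder T) → y ∈ inorder T → y′ ∈ inorder T →
                 path T y ≡ path T y′ → y ≡ y′
path-injective T y y′ s y∈ y′∈ e =
  just-injective (trans (sym (follow-path T y s y∈)) (trans (cong (follow T) e) (follow-path T y′ s y′∈)))

bst-sorted : ∀ n T → IsBSTOn n T → Sorted (inorder T)
bst-sorted n T e = subst Sorted (sym (trans e (map-upTo suc n)))
  (AllPairs.applyUpTo⁺₁ suc n (λ i<j _ → s≤s i<j))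

bst-member : ∀ n T → IsBSTOn n T → ∀ y → InRange n y → y ∈ inorder T
bst-member n T e (suc y) (_ , y<n) = subst (suc y ∈_) (sym e) (∈-map⁺ suc (∈-upTo⁺ y<n))

-- Nodes are identified with their root paths; the tree distance of
-- two nodes is  |p| + |q| − 2·lcp(p,q).  For a path p and radius d we list explicitly
-- a set of at most 2^(d+2) paths containing every q at distance ≤ d from p; by path
-- injectivity a BST therefore has at most 2^(d+2) keys within distance d of any key.

pathDist : List Bool → List Bool → ℕ
pathDist p q = (length p + length q) ∸ 2 * lcp p q

lcp-comm : ∀ p q → lcp p q ≡ lcp q p
lcp-comm [] [] = refl
lcp-comm [] (false ∷ q) = refl
lcp-comm [] (true ∷ q) = refl
lcp-comm (false ∷ p) [] = refl
lcp-comm (true ∷ p) [] = refl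
lcp-comm (false ∷ p) (false ∷ q) = cong suc (lcp-comm p q)
lcp-comm (false ∷ p) (true ∷ q) = refl
lcp-comm (true ∷ p) (false ∷ q) = refl
lcp-comm (true ∷ p) (true ∷ q) = cong suc (lcp-comm p q)

pathDist-comm : ∀ p q → pathDist p q ≡ pathDist q p
pathDist-comm p q = cong₂ _∸_ (+-comm (length p) (length q)) (cong (2 *_) (lcp-comm p q))

pathDist-step : ∀ b p q → pathDist (b ∷ p) (b ∷ q) ≡ pathDist p q
pathDist-step false p q = begin
  (suc (length p) + suc (length q)) ∸ 2 * suc (lcp p q)
    ≡⟨ cong₂ _∸_ (cong suc (+-suc (length p) (length q))) (*-suc 2 (lcp p q)) ⟩
  (2 + (length p + length q)) ∸ (2 + 2 * lcp p q)
    ≡⟨ [m+n]∸[m+o]≡n∸o 2 (length p + length q) (2 * lcp p q) ⟩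
  pathDist p q ∎
  where open ≡-Reasoning
pathDist-step true p q = pathDist-step false p q

shorterThan : ℕ → List (List Bool)
shorterThan zero = []
shorterThan (suc t) = [] ∷ (map (false ∷_) (shorterThan t) ++ map (true ∷_) (shorterThan t))

shorterThan-length : ∀ t → suc (length (shorterThan t)) ≡ 2 ^ t
shorterThan-length zero = refl
shorterThan-length (suc t) = begin
  suc (suc (length (map (false ∷_) (shorterThan t) ++ map (true ∷_) (shorterThan t))))
    ≡⟨ cong (λ z → suc (suc z)) (trans (length-++ (map (false ∷_) (shorterThan t)))
                                         (cong₂ _+_ (length-map _ (shorterThan t)) (length-map _ (shorterThan t)))) ⟩
  suc (suc (ℓ + ℓ))         ≡⟨ cong suc (sym (+-suc ℓ ℓ)) ⟩
  suc ℓ + suc ℓ             ≡⟨ cong₂ _+_ (shorterThan-length t) (shorterThan-length t) ⟩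
  2 ^ t + 2 ^ t             ≡⟨ cong (2 ^ t +_) (sym (+-identityʳ (2 ^ t))) ⟩
  2 ^ suc t                 ∎
  where
  open ≡-Reasoning
  ℓ : ℕ
  ℓ = length (shorterThan t)

shorterThan-complete : ∀ t q → length q < t → q ∈ shorterThan t
shorterThan-complete (suc t) [] _ = here refl
shorterThan-complete (suc t) (false ∷ q) (s≤s |q|<t) =
  there (∈-++⁺ˡ (∈-map⁺ (false ∷_) (shorterThan-complete t q |q|<t)))
shorterThan-complete (suc t) (true ∷ q) (s≤s |q|<t) =
  there (∈-++⁺ʳ (map (false ∷_) (shorterThan t)) (∈-map⁺ (true ∷_) (shorterThan-complete t q |q|<t)))

-- seen from depth l − 1 on a path whose next step is b: the node there itself and the
-- nodes of its other subtree (turning ¬ b) that are within distance d of depth l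
branchOff : Bool → ℕ → ℕ → List (List Bool)
branchOff b l d with l ≤? d
... | yes _ = [] ∷ map (not b ∷_) (shorterThan (d ∸ l))
... | no _ = []

branchOff-length : ∀ b l d → length (branchOff b (suc l) d) + 2 ^ (d ∸ suc l) ≤ 2 ^ (d ∸ l)
branchOff-length b l d with suc l ≤? d
branchOff-length b l (suc d) | yes (s≤s l≤d) = ≤-reflexive (begin
  suc (length (map (not b ∷_) (shorterThan (d ∸ l)))) + 2 ^ (d ∸ l)
    ≡⟨ cong (λ z → suc z + 2 ^ (d ∸ l)) (length-map _ (shorterThan (d ∸ l))) ⟩
  suc (length (shorterThan (d ∸ l))) + 2 ^ (d ∸ l)
    ≡⟨ cong (_+ 2 ^ (d ∸ l)) (shorterThan-length (d ∸ l)) ⟩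
  2 ^ (d ∸ l) + 2 ^ (d ∸ l)  ≡⟨ cong (2 ^ (d ∸ l) +_) (sym (+-identityʳ _)) ⟩
  2 ^ suc (d ∸ l)            ≡⟨ cong (2 ^_) (sym (+-∸-assoc 1 l≤d)) ⟩
  2 ^ (suc d ∸ l)            ∎)
  where open ≡-Reasoning
... | no l≰d = subst (_≤ 2 ^ (d ∸ l)) (cong (2 ^_) (sym (m≤n⇒m∸n≡0 (≰⇒≥ l≰d))))
                     (^-monoʳ-≤ 2 {0} {d ∸ l} z≤n)

nearPaths : List Bool → ℕ → List (List Bool)
nearPaths [] d = shorterThan (suc d)
nearPaths (b ∷ p) d = map (b ∷_) (nearPaths p d) ++ branchOff b (suc (length p)) d

nearPaths-length : ∀ p d → length (nearPaths p d) + 2 ^ (d ∸ length p) ≤ 2 ^ (d + 2)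
nearPaths-length [] d = begin
  length (shorterThan (suc d)) + 2 ^ d        ≤⟨ +-monoˡ-≤ (2 ^ d) (n≤1+n _) ⟩
  suc (length (shorterThan (suc d))) + 2 ^ d  ≡⟨ cong (_+ 2 ^ d) (shorterThan-length (suc d)) ⟩
  2 ^ suc d + 2 ^ d                           ≤⟨ +-monoʳ-≤ (2 ^ suc d) (^-monoʳ-≤ 2 (n≤1+n d)) ⟩
  2 ^ suc d + 2 ^ suc d                       ≡⟨ cong (2 ^ suc d +_) (sym (+-identityʳ (2 ^ suc d))) ⟩
  2 ^ suc (suc d)                             ≡⟨ cong (2 ^_) (+-comm 2 d) ⟩
  2 ^ (d + 2)                                 ∎
  where open ≤-Reasoning
nearPaths-length (b ∷ p) d = begin
  length (map (b ∷_) (nearPaths p d) ++ branchOff b (suc (length p)) d) + 2 ^ (d ∸ suc (length p))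
    ≡⟨ cong (_+ 2 ^ (d ∸ suc (length p)))
            (trans (length-++ (map (b ∷_) (nearPaths p d)))
                   (cong (_+ length (branchOff b (suc (length p)) d)) (length-map _ (nearPaths p d)))) ⟩
  length (nearPaths p d) + length (branchOff b (suc (length p)) d) + 2 ^ (d ∸ suc (length p))
    ≡⟨ +-assoc (length (nearPaths p d)) _ _ ⟩
  length (nearPaths p d) + (length (branchOff b (suc (length p)) d) + 2 ^ (d ∸ suc (length p)))
    ≤⟨ +-monoʳ-≤ (length (nearPaths p d)) (branchOff-length b (length p) d) ⟩
  length (nearPaths p d) + 2 ^ (d ∸ length p)
    ≤⟨ nearPaths-length p d ⟩
  2 ^ (d + 2) ∎
  where open ≤-Reasoning

nearPaths-complete : ∀ p q d → pathDist p q ≤ d → q ∈ nearPaths p d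
nearPaths-complete [] q d q-near = shorterThan-complete (suc d) q (s≤s q-near)
nearPaths-complete (b ∷ p) [] d q-near =
  ∈-++⁺ʳ (map (b ∷_) (nearPaths p d)) (ancestor (lcp-root b))
  where
  lcp-root : ∀ b → lcp (b ∷ p) [] ≡ 0
  lcp-root false = refl
  lcp-root true = refl
  ancestor : lcp (b ∷ p) [] ≡ 0 → [] ∈ branchOff b (suc (length p)) d
  ancestor e with suc (length p) ≤? d
  ... | yes _ = here refl
  ... | no |p|≰d = ⊥-elim (|p|≰d (subst (_≤ d) (trans (cong (λ z → (suc (length p) + 0) ∸ 2 * z) e) (+-identityʳ _)) q-near))
nearPaths-complete (b ∷ p) (c ∷ q) d q-near with Bool._≟_ b c
... | yes refl = ∈-++⁺ˡ (∈-map⁺ _ (nearPaths-complete p q d (subst (_≤ d) (pathDist-step b p q) q-near)))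
... | no b≢c = ∈-++⁺ʳ (map (b ∷_) (nearPaths p d)) (sibling (lcp-split b c b≢c))
  where
  lcp-split : ∀ b c → b ≢ c → lcp (b ∷ p) (c ∷ q) ≡ 0
  lcp-split false false ne = ⊥-elim (ne refl)
  lcp-split false true _ = refl
  lcp-split true false _ = refl
  lcp-split true true ne = ⊥-elim (ne refl)
  not-flip : ∀ b c → b ≢ c → not b ≡ c
  not-flip false false ne = ⊥-elim (ne refl)
  not-flip false true _ = refl
  not-flip true false _ = refl
  not-flip true true ne = ⊥-elim (ne refl)
  total : suc (length p) + suc (length q) ≤ d
  total = subst (_≤ d) (trans (cong (λ z → (suc (length p) + suc (length q)) ∸ 2 * z) (lcp-split b c b≢c)) refl) q-near
  sibling : lcp (b ∷ p) (c ∷ q) ≡ 0 → (c ∷ q) ∈ branchOff b (suc (length p)) d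
  sibling _ with suc (length p) ≤? d
  ... | yes _ = there (subst (λ z → (z ∷ q) ∈ map (not b ∷_) (shorterThan (d ∸ suc (length p))))
                            (not-flip b c b≢c) (∈-map⁺ _ (shorterThan-complete _ q |q|<)))
    where
    |q|< : length q < d ∸ suc (length p)
    |q|< = ≤-trans (≤-reflexive (sym (m+n∸m≡n (suc (length p)) (suc (length q)))))
                   (∸-monoˡ-≤ (suc (length p)) total)
  ... | no |p|≰d = ⊥-elim (|p|≰d (≤-trans (m≤m+n _ _) total))

ball-size : ∀ n T → IsBSTOn n T → ∀ x d (zs : List ℕ) → Unique zs →
            All (λ z → InRange n z × dist T z x ≤ d) zs → length zs ≤ 2 ^ (d + 2)
ball-size n T bst x d zs u near = begin
  length zs                          ≡⟨ sym (length-map (path T) zs) ⟩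
  length (map (path T) zs)           ≤⟨ pigeonhole (map (path T) zs) (nearPaths (path T x) d) (paths-unique zs u near) ⊆near ⟩
  length (nearPaths (path T x) d)    ≤⟨ m≤m+n _ _ ⟩
  length (nearPaths (path T x) d) + 2 ^ (d ∸ length (path T x)) ≤⟨ nearPaths-length (path T x) d ⟩
  2 ^ (d + 2)                        ∎
  where
  open ≤-Reasoning
  open Pigeonhole (≡-dec Bool._≟_)
  Near : ℕ → Set
  Near = λ z → InRange n z × dist T z x ≤ d
  distinct-paths : ∀ z → InRange n z → ∀ ws → All (z ≢_) ws → All Near ws → All (path T z ≢_) (map (path T) ws)
  distinct-paths z z∈ [] _ _ = []
  distinct-paths z z∈ (w ∷ ws) (z≢w ∷ z≢ws) ((w∈ , _) ∷ near) =
    (λ e → z≢w (path-injective T z w (bst-sorted n T bst) (bst-member n T bst z z∈) (bst-member n T bst w w∈) e))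
    ∷ distinct-paths z z∈ ws z≢ws near
  paths-unique : ∀ zs → Unique zs → All Near zs → Unique (map (path T) zs)
  paths-unique [] _ _ = []
  paths-unique (z ∷ zs) (z∉ ∷ u) ((z∈ , _) ∷ near) = distinct-paths z z∈ zs z∉ near ∷ paths-unique zs u near
  ⊆near : ∀ {q} → q ∈ map (path T) zs → q ∈ nearPaths (path T x) d
  ⊆near q∈ with ∈-map⁻ (path T) q∈
  ... | z , z∈ , refl = nearPaths-complete (path T x) (path T z) d
                          (subst (_≤ d) (pathDist-comm (path T z) (path T x)) (proj₂ (All.lookup near z∈)))

sumOver : {A : Set} → (A → ℕ) → List A → ℕ
sumOver c [] = 0
sumOver c (x ∷ xs) = c x + sumOver c xs

-- A history records, most recent first,
-- which finger served which request.  historyCost charges each request the distance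
-- from the previous request served by the same finger *within the history*, and nothing
-- for a finger's first use there.  It never exceeds the true cost, and restarting the
-- history at block boundaries only lowers it further.

module FingerHistory (T : Tree) (k : ℕ) where

  History : Set
  History = List (Fin k × ℕ)

  lastUse : History → Fin k → Maybe ℕ
  lastUse [] f = nothing
  lastUse ((g , a) ∷ h) f with f Fin.≟ g
  ... | yes _ = just a
  ... | no _ = lastUse h f

  moveCost : ℕ → Maybe ℕ → ℕ
  moveCost a nothing = 0
  moveCost a (just b) = dist T a b

  historyCost : History → List ℕ → List (Fin k) → ℕ
  historyCost h (a ∷ as) (f ∷ fs) = moveCost a (lastUse h f) + historyCost ((f , a) ∷ h) as fs
  historyCost h _ _ = 0

  Consistent : Vec ℕ k → History → Set
  Consistent loc h = ∀ f b → lastUse h f ≡ just b → lookup loc f ≡ b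

  historyCost≤fingerCost : ∀ loc h → Consistent loc h → ∀ as fs → historyCost h as fs ≤ fingerCost T loc as fs
  historyCost≤fingerCost loc h _ [] fs = z≤n
  historyCost≤fingerCost loc h _ (a ∷ as) [] = z≤n
  historyCost≤fingerCost loc h cons (a ∷ as) (f ∷ fs) =
    +-mono-≤ (≤-trans move (n≤1+n _)) (historyCost≤fingerCost (loc [ f ]≔ a) ((f , a) ∷ h) cons′ as fs)
    where
    move : moveCost a (lastUse h f) ≤ dist T a (lookup loc f)
    move with lastUse h f in e
    ... | nothing = z≤n
    ... | just b = ≤-reflexive (cong (dist T a) (sym (cons f b e)))
    cons′ : Consistent (loc [ f ]≔ a) ((f , a) ∷ h)
    cons′ g b e with g Fin.≟ f
    cons′ g b refl | yes refl = lookup∘update f loc a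
    ... | no g≢f = trans (lookup∘update′ g≢f loc a) (cons g b e)

  lastUse-++ : ∀ p h f b → lastUse p f ≡ just b → lastUse (p ++ h) f ≡ just b
  lastUse-++ ((g , a) ∷ p) h f b e with f Fin.≟ g
  ... | yes _ = e
  ... | no _ = lastUse-++ p h f b e

  moveCost-mono : ∀ p h a f → moveCost a (lastUse p f) ≤ moveCost a (lastUse (p ++ h) f)
  moveCost-mono p h a f with lastUse p f in e
  ... | nothing = z≤n
  ... | just b rewrite lastUse-++ p h f b e = ≤-refl

  historyCost-mono : ∀ p h as fs → historyCost p as fs ≤ historyCost (p ++ h) as fs
  historyCost-mono p h [] fs = z≤n
  historyCost-mono p h (a ∷ as) [] = z≤n
  historyCost-mono p h (a ∷ as) (f ∷ fs) =
    +-mono-≤ (moveCost-mono p h a f) (historyCost-mono ((f , a) ∷ p) h as fs)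

  historyCost-split : ∀ p h xs ys fs →
    historyCost p xs (take (length xs) fs) + historyCost [] ys (drop (length xs) fs) ≤ historyCost (p ++ h) (xs ++ ys) fs
  historyCost-split p h [] ys fs = historyCost-mono [] (p ++ h) ys fs
  historyCost-split p h (x ∷ xs) [] [] = z≤n
  historyCost-split p h (x ∷ xs) (y ∷ ys) [] = z≤n
  historyCost-split p h (x ∷ xs) ys (f ∷ fs) = begin
    (moveCost x (lastUse p f) + historyCost ((f , x) ∷ p) xs (take (length xs) fs)) + historyCost [] ys (drop (length xs) fs)
      ≡⟨ +-assoc (moveCost x (lastUse p f)) _ _ ⟩
    moveCost x (lastUse p f) + (historyCost ((f , x) ∷ p) xs (take (length xs) fs) + historyCost [] ys (drop (length xs) fs))
      ≤⟨ +-mono-≤ (moveCost-mono p h x f) (historyCost-split ((f , x) ∷ p) h xs ys fs) ⟩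
    moveCost x (lastUse (p ++ h) f) + historyCost ((f , x) ∷ p ++ h) (xs ++ ys) fs ∎
    where open ≤-Reasoning

  roundsCost : List (List ℕ) → List (Fin k) → ℕ
  roundsCost [] fs = 0
  roundsCost (r ∷ rs) fs = historyCost [] r (take (length r) fs) + roundsCost rs (drop (length r) fs)

  roundsCost≤historyCost : ∀ h rs fs → roundsCost rs fs ≤ historyCost h (concat rs) fs
  roundsCost≤historyCost h [] fs = z≤n
  roundsCost≤historyCost h (r ∷ rs) fs =
    ≤-trans (+-monoʳ-≤ (historyCost [] r (take (length r) fs)) (roundsCost≤historyCost [] rs (drop (length r) fs)))
            (historyCost-split [] h r (concat rs) fs)

  newFingers : History → List ℕ → List (Fin k) → List (Fin k)
  newFingers h (a ∷ as) (f ∷ fs) with lastUse h f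
  ... | nothing = f ∷ newFingers ((f , a) ∷ h) as fs
  ... | just _ = newFingers ((f , a) ∷ h) as fs
  newFingers h _ _ = []

  lastUse-unused : ∀ h f a g → lastUse ((f , a) ∷ h) g ≡ nothing → lastUse h g ≡ nothing × f ≢ g
  lastUse-unused h f a g e with g Fin.≟ f
  lastUse-unused h f a g () | yes _
  ... | no g≢f = e , λ f≡g → g≢f (sym f≡g)

  newFingers-fresh : ∀ h as fs → Unique (newFingers h as fs) × All (λ f → lastUse h f ≡ nothing) (newFingers h as fs)
  newFingers-fresh h [] fs = [] , []
  newFingers-fresh h (a ∷ as) [] = [] , []
  newFingers-fresh h (a ∷ as) (f ∷ fs) with lastUse h f in e | newFingers-fresh ((f , a) ∷ h) as fs
  ... | nothing | u , fresh =
        (All.map (λ {g} e′ → proj₂ (lastUse-unused h f a g e′)) fresh ∷ u)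
      , (e ∷ All.map (λ {g} e′ → proj₁ (lastUse-unused h f a g e′)) fresh)
  ... | just _ | u , fresh = u , All.map (λ {g} e′ → proj₁ (lastUse-unused h f a g e′)) fresh

  newFingers≤k : ∀ as fs → length (newFingers [] as fs) ≤ k
  newFingers≤k as fs = subst (length (newFingers [] as fs) ≤_) (length-tabulate (λ f → f))
    (pigeonhole (newFingers [] as fs) (allFin k) (proj₁ (newFingers-fresh [] as fs)) (λ {f} _ → ∈-allFin f))
    where open Pigeonhole Fin._≟_

sumOver-++ : {A : Set} (c : A → ℕ) (xs ys : List A) → sumOver c (xs ++ ys) ≡ sumOver c xs + sumOver c ys
sumOver-++ c [] ys = refl
sumOver-++ c (x ∷ xs) ys = trans (cong (c x +_) (sumOver-++ c xs ys)) (sym (+-assoc (c x) _ _))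

length-concat : ∀ L (rs : List (List ℕ)) → All (λ r → length r ≡ L) rs → length (concat rs) ≡ L * length rs
length-concat L [] [] = sym (*-zeroʳ L)
length-concat L (r ∷ rs) (|r| ∷ rounds) =
  trans (length-++ r) (trans (cong₂ _+_ |r| (length-concat L rs rounds)) (sym (*-suc L (length rs))))

module Closeness (T : Tree) (n d : ℕ) where

  Close : ℕ → ℕ → Set
  Close b a = dist T a b ≤ d × InRange n a

  close : ℕ → ℕ → ℕ
  close b a with dist T a b ≤? d ×-dec ((1 ≤? a) ×-dec (a ≤? n))
  ... | yes _ = 1
  ... | no _ = 0

  close≤1 : ∀ b a → close b a ≤ 1
  close≤1 b a with dist T a b ≤? d ×-dec ((1 ≤? a) ×-dec (a ≤? n))
  ... | yes _ = ≤-refl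
  ... | no _ = z≤n

  close-sound : ∀ b a → close b a ≡ 1 → Close b a
  close-sound b a e with dist T a b ≤? d ×-dec ((1 ≤? a) ×-dec (a ≤? n))
  close-sound b a refl | yes c = c

  far-unless-close : ∀ b a → InRange n a → close b a ≡ 0 → d < dist T a b
  far-unless-close b a a∈ e with dist T a b ≤? d ×-dec ((1 ≤? a) ×-dec (a ≤? n))
  far-unless-close b a a∈ () | yes _
  ... | no ¬close = ≰⇒> (λ near → ¬close (near , a∈))

  closeCount : ℕ → List ℕ → ℕ
  closeCount a = sumOver (λ b → close b a)

  closeCount-member : ∀ a b xs → b ∈ xs → close b a ≤ closeCount a xs
  closeCount-member a b (x ∷ xs) (here refl) = m≤m+n _ _
  closeCount-member a b (x ∷ xs) (there b∈) = ≤-trans (closeCount-member a b xs b∈) (m≤n+m _ _)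

  closePairs : List ℕ → List ℕ → ℕ
  closePairs prev [] = 0
  closePairs prev (a ∷ r) = closeCount a prev + closePairs (prev ++ [ a ]) r

-- A request served by a finger already used in the round either
-- costs more than d (its previous location is far), or is close to an earlier request;
-- the remaining requests are first uses of fingers.  Hence a round of 2k requests pays
-- at least (d+1)·k, up to (d+1) times its number of close pairs.

IsRound : ℕ → ℕ → List ℕ → Set
IsRound n k r = length r ≡ 2 * k × All (InRange n) r

module RoundCharge (T : Tree) (n d k : ℕ) where
  open FingerHistory T k
  open Closeness T n d

  charged-or-close : ∀ a b prev → InRange n a → b ∈ prev → suc d ≤ dist T a b + suc d * closeCount a prev
  charged-or-close a b prev a∈ b∈ with close b a in e
  ... | zero = ≤-trans (far-unless-close b a a∈ e) (m≤m+n _ _)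
  ... | suc c = begin
    suc d                                 ≡⟨ sym (*-identityʳ (suc d)) ⟩
    suc d * 1                             ≤⟨ *-monoʳ-≤ (suc d) one-close ⟩
    suc d * closeCount a prev             ≤⟨ m≤n+m _ (dist T a b) ⟩
    dist T a b + suc d * closeCount a prev ∎
    where
    open ≤-Reasoning
    one-close : 1 ≤ closeCount a prev
    one-close = ≤-trans (s≤s (z≤n {c})) (subst (_≤ closeCount a prev) e (closeCount-member a b prev b∈))

  lastUse-recorded : ∀ h f b prev → All (λ p → proj₂ p ∈ prev) h → lastUse h f ≡ just b → b ∈ prev
  lastUse-recorded ((g , a) ∷ h) f b prev (a∈ ∷ rec) e with f Fin.≟ g
  lastUse-recorded ((g , a) ∷ h) f b prev (a∈ ∷ rec) refl | yes _ = a∈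
  ... | no _ = lastUse-recorded h f b prev rec e

  recorded-extend : ∀ (f : Fin k) a (h : History) prev → All (λ p → proj₂ p ∈ prev) h → All (λ p → proj₂ p ∈ prev ++ [ a ]) ((f , a) ∷ h)
  recorded-extend f a h prev rec = ∈-++⁺ʳ prev (here refl) ∷ All.map ∈-++⁺ˡ rec

  -- one request: the inductive step of round-charge, as arithmetic
  step-bound : ∀ s l X Y Z c C w → s ≤ c + s * C + s * w → s * l ≤ X + s * Y + s * Z →
               s * suc l ≤ (c + X) + s * (C + Y) + s * (w + Z)
  step-bound s l X Y Z c C w now later = begin
    s * suc l                                         ≡⟨ *-suc s l ⟩
    s + s * l                                         ≤⟨ +-mono-≤ now later ⟩
    (c + s * C + s * w) + (X + s * Y + s * Z)         ≡⟨ solve 8 (λ s X Y Z c C w l → (c :+ s :* C :+ s :* w) :+ (X :+ s :* Y :+ s :* Z)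
                                                                 := (c :+ X) :+ s :* (C :+ Y) :+ s :* (w :+ Z)) refl s X Y Z c C w l ⟩
    (c + X) + s * (C + Y) + s * (w + Z)               ∎
    where open ≤-Reasoning

  round-charge : ∀ h prev r fs → All (λ p → proj₂ p ∈ prev) h → All (InRange n) r → length r ≤ length fs →
                 suc d * length r ≤ historyCost h r fs + suc d * closePairs prev r + suc d * length (newFingers h r fs)
  round-charge h prev [] fs rec r∈ r≤fs = ≤-trans (≤-reflexive (*-zeroʳ (suc d))) z≤n
  round-charge h prev (a ∷ r) (f ∷ fs) rec (a∈ ∷ r∈) (s≤s r≤fs) with lastUse h f in e
  ... | nothing = step-bound (suc d) (length r) (historyCost ((f , a) ∷ h) r fs) (closePairs (prev ++ [ a ]) r) (length (newFingers ((f , a) ∷ h) r fs)) 0 (closeCount a prev) 1 fresh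
                    (round-charge ((f , a) ∷ h) (prev ++ [ a ]) r fs (recorded-extend f a h prev rec) r∈ r≤fs)
    where
    fresh : suc d ≤ 0 + suc d * closeCount a prev + suc d * 1
    fresh = ≤-trans (≤-reflexive (sym (*-identityʳ (suc d)))) (m≤n+m _ _)
  ... | just b = step-bound (suc d) (length r) (historyCost ((f , a) ∷ h) r fs) (closePairs (prev ++ [ a ]) r) (length (newFingers ((f , a) ∷ h) r fs)) (dist T a b) (closeCount a prev) 0 reused
                   (round-charge ((f , a) ∷ h) (prev ++ [ a ]) r fs (recorded-extend f a h prev rec) r∈ r≤fs)
    where
    reused : suc d ≤ dist T a b + suc d * closeCount a prev + suc d * 0
    reused = ≤-trans (charged-or-close a b prev a∈ (lastUse-recorded h f b prev rec e)) (m≤m+n _ _)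

  round-lower : ∀ r fs → length r ≡ 2 * k → All (InRange n) r → length r ≤ length fs →
                suc d * k ≤ historyCost [] r fs + suc d * closePairs [] r
  round-lower r fs |r|≡2k r∈ r≤fs = +-cancelʳ-≤ (suc d * k) _ _ (begin
    suc d * k + suc d * k  ≡⟨ solve 2 (λ s k → s :* k :+ s :* k := s :* (con 2 :* k)) refl (suc d) k ⟩
    suc d * (2 * k)        ≡⟨ cong (suc d *_) (sym |r|≡2k) ⟩
    suc d * length r       ≤⟨ round-charge [] [] r fs [] r∈ r≤fs ⟩
    historyCost [] r fs + suc d * closePairs [] r + suc d * length (newFingers [] r fs)
                           ≤⟨ +-monoʳ-≤ (historyCost [] r fs + suc d * closePairs [] r) (*-monoʳ-≤ (suc d) (newFingers≤k r fs)) ⟩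
    historyCost [] r fs + suc d * closePairs [] r + suc d * k ∎)
    where open ≤-Reasoning

  rounds-lower : ∀ rs fs → All (IsRound n k) rs → length (concat rs) ≤ length fs →
                 suc d * k * length rs ≤ roundsCost rs fs + suc d * sumOver (closePairs []) rs
  rounds-lower [] fs _ _ = ≤-trans (≤-reflexive (*-zeroʳ (suc d * k))) z≤n
  rounds-lower (r ∷ rs) fs ((|r|≡2k , r∈) ∷ rounds) r++rs≤fs = begin
    suc d * k * suc (length rs)   ≡⟨ *-suc (suc d * k) (length rs) ⟩
    suc d * k + suc d * k * length rs
      ≤⟨ +-mono-≤ (round-lower r (take (length r) fs) |r|≡2k r∈ r≤) (rounds-lower rs (drop (length r) fs) rounds rs≤) ⟩
    (historyCost [] r fs₁ + suc d * closePairs [] r) + (roundsCost rs fs₂ + suc d * sumOver (closePairs []) rs)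
      ≡⟨ solve 5 (λ s a b c e → (a :+ s :* b) :+ (c :+ s :* e) := (a :+ c) :+ s :* (b :+ e))
               refl (suc d) (historyCost [] r fs₁) (closePairs [] r) (roundsCost rs fs₂) (sumOver (closePairs []) rs) ⟩
    (historyCost [] r fs₁ + roundsCost rs fs₂) + suc d * (closePairs [] r + sumOver (closePairs []) rs) ∎
    where
    open ≤-Reasoning
    fs₁ : List (Fin k)
    fs₁ = take (length r) fs
    fs₂ : List (Fin k)
    fs₂ = drop (length r) fs
    both≤ : length r + length (concat rs) ≤ length fs
    both≤ = ≤-trans (≤-reflexive (sym (length-++ r))) r++rs≤fs
    r≤ : length r ≤ length fs₁
    r≤ = ≤-reflexive (sym (trans (length-take (length r) fs) (m≤n⇒m⊓n≡m (≤-trans (m≤m+n _ _) both≤))))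
    rs≤ : length (concat rs) ≤ length fs₂
    rs≤ = subst (length (concat rs) ≤_) (sym (length-drop (length r) fs))
            (subst (_≤ length fs ∸ length r) (m+n∸m≡n (length r) (length (concat rs))) (∸-monoˡ-≤ (length r) both≤))

module SequenceCharge (T : Tree) (n d k : ℕ) where
  open FingerHistory T k
  open Closeness T n d
  open RoundCharge T n d k

  sequence-lower : ∀ rs (ℓ : Vec ℕ k) fs → All (IsRound n k) rs → length fs ≡ length (concat rs) →
                   2 * sumOver (closePairs []) rs ≤ k * length rs →
                   suc d * length (concat rs) ≤ 4 * fingerCost T ℓ (concat rs) fs
  sequence-lower rs ℓ fs rounds |fs| sparse = begin
    suc d * length (concat rs)  ≡⟨ cong (suc d *_) (length-concat (2 * k) rs (All.map proj₁ rounds)) ⟩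
    suc d * (2 * k * length rs) ≡⟨ solve 3 (λ s k r → s :* (con 2 :* k :* r) := con 2 :* (s :* k :* r)) refl (suc d) k (length rs) ⟩
    2 * Y                       ≤⟨ *-monoʳ-≤ 2 Y≤2X ⟩
    2 * (2 * X)                 ≡⟨ sym (*-assoc 2 2 X) ⟩
    4 * X                       ≤⟨ *-monoʳ-≤ 4 X≤cost ⟩
    4 * fingerCost T ℓ (concat rs) fs ∎
    where
    open ≤-Reasoning
    X : ℕ
    X = roundsCost rs fs
    Y : ℕ
    Y = suc d * k * length rs
    Z : ℕ
    Z = suc d * sumOver (closePairs []) rs
    X≤cost : X ≤ fingerCost T ℓ (concat rs) fs
    X≤cost = ≤-trans (roundsCost≤historyCost [] rs fs) (historyCost≤fingerCost ℓ [] (λ _ _ ()) (concat rs) fs)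
    Y≤X+Z : Y ≤ X + Z
    Y≤X+Z = rounds-lower rs fs rounds (≤-reflexive (sym |fs|))
    2Z≤Y : 2 * Z ≤ Y
    2Z≤Y = begin
      2 * (suc d * sumOver (closePairs []) rs) ≡⟨ solve 2 (λ s c → con 2 :* (s :* c) := s :* (con 2 :* c)) refl (suc d) (sumOver (closePairs []) rs) ⟩
      suc d * (2 * sumOver (closePairs []) rs) ≤⟨ *-monoʳ-≤ (suc d) sparse ⟩
      suc d * (k * length rs)                  ≡⟨ sym (*-assoc (suc d) k (length rs)) ⟩
      Y                                        ∎
    Y≤2X : Y ≤ 2 * X
    Y≤2X = +-cancelʳ-≤ Y Y (2 * X) (begin
      Y + Y              ≤⟨ +-mono-≤ Y≤X+Z Y≤X+Z ⟩
      (X + Z) + (X + Z)  ≡⟨ solve 2 (λ X Z → (X :+ Z) :+ (X :+ Z) := con 2 :* X :+ con 2 :* Z) refl X Z ⟩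
      2 * X + 2 * Z      ≤⟨ +-monoʳ-≤ (2 * X) 2Z≤Y ⟩
      2 * X + Y          ∎)

distinct-hits : (y : ℕ → ℕ) → (∀ g → y g < y (suc g)) → (F : ℕ → ℕ) → (∀ g → F g ≤ 1) →
                (P : ℕ → Set) → (∀ g → F g ≡ 1 → P (y g)) → ∀ h →
                Σ (List ℕ) λ zs → Unique zs × All P zs × All (_< y h) zs × sumN h F ≤ length zs
distinct-hits y inc F F≤1 P hit zero = [] , [] , [] , [] , z≤n
distinct-hits y inc F F≤1 P hit (suc h) with distinct-hits y inc F F≤1 P hit h | F h in e
... | zs , u , ps , below , count | zero =
      zs , u , ps , All.map (λ z< → <-trans z< (inc h)) below , ≤-trans (≤-reflexive (+-identityʳ _)) count
... | zs , u , ps , below , count | suc zero =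
      (y h ∷ zs) , (All.map (λ z< z≡ → <-irrefl (sym z≡) z<) below ∷ u) , (hit h e ∷ ps)
    , (inc h ∷ All.map (λ z< → <-trans z< (inc h)) below) , ≤-trans (≤-reflexive (+-comm _ 1)) (s≤s count)
... | _ | suc (suc _) = ⊥-elim (<-irrefl refl (≤-trans (s≤s (s≤s z≤n)) (subst (_≤ 1) e (F≤1 h))))

progression : (ℕ → ℕ) → ℕ → ℕ → List ℕ
progression e j zero = []
progression e j (suc t) = e j ∷ progression e (suc j) t

prefix : (ℕ → ℕ) → ℕ → List ℕ
prefix e zero = []
prefix e (suc j) = prefix e j ++ [ e j ]

progression-length : ∀ e j t → length (progression e j t) ≡ t
progression-length e j zero = refl
progression-length e j (suc t) = cong suc (progression-length e (suc j) t)

progression-all : ∀ (P : ℕ → Set) e j t → (∀ i → i < j + t → P (e i)) → All P (progression e j t)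
progression-all P e j zero p = []
progression-all P e j (suc t) p =
  p j (subst (j <_) (sym (+-suc j t)) (s≤s (m≤m+n j t)))
  ∷ progression-all P e (suc j) t (λ i i< → p i (subst (i <_) (sym (+-suc j t)) i<))

module ClosePairTotals (T : Tree) (n d : ℕ) where
  open Closeness T n d

  closeCount-prefix : ∀ e a j → closeCount a (prefix e j) ≡ sumN j (λ i → close (e i) a)
  closeCount-prefix e a zero = refl
  closeCount-prefix e a (suc j) =
    trans (sumOver-++ (λ b → close b a) (prefix e j) [ e j ])
          (cong₂ _+_ (closeCount-prefix e a j) (+-identityʳ (close (e j) a)))

  closePairs-progression : ∀ e j t → closePairs (prefix e j) (progression e j t)
                                     ≡ sumN t (λ u → sumN (j + u) (λ i → close (e i) (e (j + u))))
  closePairs-progression e j zero = refl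
  closePairs-progression e j (suc t) = begin
    closeCount (e j) (prefix e j) + closePairs (prefix e (suc j)) (progression e (suc j) t)
      ≡⟨ cong₂ _+_ (closeCount-prefix e (e j) j) (closePairs-progression e (suc j) t) ⟩
    sumN j (λ i → close (e i) (e j)) + sumN t (λ u → sumN (suc j + u) (λ i → close (e i) (e (suc j + u))))
      ≡⟨ cong₂ _+_ (cong F′ (sym (+-identityʳ j))) (sumN-cong t _ _ (λ u → cong F′ (sym (+-suc j u)))) ⟩
    F 0 + sumN t (λ u → F (suc u))
      ≡⟨ sym (sumN-head t F) ⟩
    sumN (suc t) F ∎
    where
    open ≡-Reasoning
    F′ : ℕ → ℕ
    F′ v = sumN v (λ i → close (e i) (e v))
    F : ℕ → ℕ
    F u = F′ (j + u)

term : ℕ → ℕ → ℕ → ℕ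
term g s j = suc s + j * suc g

round : ℕ → ℕ → ℕ → List ℕ
round L g s = progression (term g s) 0 L

-- Fix positions i < j, so the two terms differ by δ·(g+1),
-- δ = j − i.  For each x the keys x + δ(g+1), g < h, are distinct, so by the ball bound
-- at most 2^(d+2) of them are close to x.  Summing over the starts s < A and gaps g < h
-- (all terms lying in [1, M]) gives at most M·2^(d+2) close pairs per pair of positions.

module CloseRounds (T : Tree) (n d : ℕ) (bst : IsBSTOn n T) (h A M : ℕ) where
  open Closeness T n d
  open ClosePairTotals T n d

  along-gaps : ∀ x δ → 1 ≤ δ → sumN h (λ g → close x (x + δ * suc g)) ≤ 2 ^ (d + 2)
  along-gaps x δ δ≥1 with distinct-hits (λ g → x + δ * suc g) increasing (λ g → close x (x + δ * suc g))
                            (λ g → close≤1 x _) (λ z → InRange n z × dist T z x ≤ d)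
                            (λ g e → let (near , z∈) = close-sound x _ e in z∈ , near) h
    where
    increasing : ∀ g → x + δ * suc g < x + δ * suc (suc g)
    increasing g = +-monoʳ-< x (*-monoʳ-< δ {{>-nonZero δ≥1}} (n<1+n (suc g)))
  ... | zs , u , near , _ , count = ≤-trans count (ball-size n T bst x d zs u near)

  over-starts : ∀ i δ g → suc (i * suc g) + A ≤ M →
                sumN A (λ s → close (term g s i) (term g s (i + δ))) ≤ sumN M (λ x → close x (x + δ * suc g))
  over-starts i δ g fits = begin
    sumN A (λ s → close (term g s i) (term g s (i + δ)))
      ≡⟨ sumN-cong A _ _ (λ s → cong₂ close (first s) (second s)) ⟩
    sumN A (λ s → φ (c + s))
      ≤⟨ sumN-window c A M φ fits ⟩
    sumN M φ ∎
    where
    open ≤-Reasoning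
    c : ℕ
    c = suc (i * suc g)
    φ : ℕ → ℕ
    φ x = close x (x + δ * suc g)
    first : ∀ s → term g s i ≡ c + s
    first s = cong suc (+-comm s (i * suc g))
    second : ∀ s → term g s (i + δ) ≡ (c + s) + δ * suc g
    second s = begin-equality
      suc s + (i + δ) * suc g           ≡⟨ cong (suc s +_) (*-distribʳ-+ (suc g) i δ) ⟩
      suc s + (i * suc g + δ * suc g)   ≡⟨ sym (+-assoc (suc s) _ _) ⟩
      (suc s + i * suc g) + δ * suc g   ≡⟨ cong (_+ δ * suc g) (first s) ⟩
      (c + s) + δ * suc g               ∎

  position-pair : ∀ i j → i < j → (∀ g → g < h → suc (i * suc g) + A ≤ M) →
                  sumN h (λ g → sumN A (λ s → close (term g s i) (term g s j))) ≤ M * 2 ^ (d + 2)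
  position-pair i j i<j fits = begin
    sumN h (λ g → sumN A (λ s → close (term g s i) (term g s j)))
      ≡⟨ sumN-cong h _ _ (λ g → sumN-cong A _ _ (λ s → cong (λ z → close (term g s i) (term g s z)) (sym i+δ≡j))) ⟩
    sumN h (λ g → sumN A (λ s → close (term g s i) (term g s (i + δ))))
      ≤⟨ sumN-mono h _ _ (λ g g<h → over-starts i δ g (fits g g<h)) ⟩
    sumN h (λ g → sumN M (λ x → close x (x + δ * suc g)))
      ≡⟨ sumN-swap h M (λ g x → close x (x + δ * suc g)) ⟩
    sumN M (λ x → sumN h (λ g → close x (x + δ * suc g)))
      ≤⟨ sumN-bound M _ _ (λ x _ → along-gaps x δ (m<n⇒0<n∸m i<j)) ⟩
    M * 2 ^ (d + 2) ∎
    where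
    open ≤-Reasoning
    δ : ℕ
    δ = j ∸ i
    i+δ≡j : i + δ ≡ j
    i+δ≡j = m+[n∸m]≡n (<⇒≤ i<j)

  all-rounds : ∀ L → (∀ i g → i < L → g < h → suc (i * suc g) + A ≤ M) →
               sumN h (λ g → sumN A (λ s → closePairs [] (round L g s))) ≤ L * (L * (M * 2 ^ (d + 2)))
  all-rounds L fits = begin
    sumN h (λ g → sumN A (λ s → closePairs [] (round L g s)))
      ≡⟨ sumN-cong h _ _ (λ g → sumN-cong A _ _ (λ s → closePairs-progression (term g s) 0 L)) ⟩
    sumN h (λ g → sumN A (λ s → sumN L (λ j → sumN j (λ i → pair i j g s))))
      ≡⟨ sumN-cong h _ _ (λ g → sumN-swap A L _) ⟩
    sumN h (λ g → sumN L (λ j → sumN A (λ s → sumN j (λ i → pair i j g s))))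
      ≡⟨ sumN-swap h L _ ⟩
    sumN L (λ j → sumN h (λ g → sumN A (λ s → sumN j (λ i → pair i j g s))))
      ≡⟨ sumN-cong L _ _ (λ j → trans (sumN-cong h _ _ (λ g → sumN-swap A j _)) (sumN-swap h j _)) ⟩
    sumN L (λ j → sumN j (λ i → sumN h (λ g → sumN A (λ s → pair i j g s))))
      ≤⟨ sumN-bound L _ _ (λ j j<L → ≤-trans (sumN-bound j _ _ (λ i i<j → position-pair i j i<j (λ g g<h → fits i g (<-trans i<j j<L) g<h)))
                                            (*-monoˡ-≤ _ (<⇒≤ j<L))) ⟩
    L * (L * (M * 2 ^ (d + 2))) ∎
    where
    open ≤-Reasoning
    pair : ℕ → ℕ → ℕ → ℕ → ℕ
    pair i j g s = close (term g s i) (term g s j)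

-- Reading a request x with
-- reversed history rp, its working set is x together with the requests since the last
-- occurrence of x.  In a first pass through a round this is at most the whole history;
-- in a repetition of a round r it is at most 2|r| + 1, since every element of r occurred
-- during the previous |r| requests.

since : ℕ → List ℕ → List ℕ
since x = takeWhile (λ y → ¬? (y ≟ x))

wsizes-++ : ∀ rp xs ys → wsizes rp (xs ++ ys) ≡ wsizes rp xs ++ wsizes (xs ʳ++ rp) ys
wsizes-++ rp [] ys = refl
wsizes-++ rp (x ∷ xs) ys = cong (_ ∷_) (wsizes-++ (x ∷ rp) xs ys)

since-length : ∀ x rp → length (since x rp) ≤ length rp
since-length x [] = z≤n
since-length x (y ∷ rp) with y ≡ᵇ x
... | true = z≤n
... | false = s≤s (since-length x rp)

since-within : ∀ x p q → x ∈ p → length (since x (p ++ q)) ≤ length p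
since-within x (y ∷ p) q x∈ with y ≡ᵇ x in y=x
since-within x (y ∷ p) q x∈ | true = z≤n
since-within x (y ∷ p) q (here refl) | false = ⊥-elim (subst T y=x (≡⇒≡ᵇ y y refl))
since-within x (y ∷ p) q (there x∈) | false = s≤s (since-within x p q x∈)

wsize≤ : ∀ x rp → distinctCount (x ∷ since x rp) ≤ suc (length (since x rp))
wsize≤ x rp = length-deduplicate _≟_ (x ∷ since x rp)

first-pass : ∀ rp xs → product (wsizes rp xs) ≤ (length rp + length xs) ^ length xs
first-pass rp [] = ≤-refl
first-pass rp (x ∷ xs) = *-mono-≤ head
  (subst (λ z → product (wsizes (x ∷ rp) xs) ≤ z ^ length xs) (sym (+-suc (length rp) (length xs))) (first-pass (x ∷ rp) xs))
  where
  head : distinctCount (x ∷ since x rp) ≤ length rp + suc (length xs)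
  head = ≤-trans (wsize≤ x rp) (≤-trans (s≤s (since-length x rp))
                 (≤-trans (≤-reflexive (+-comm 1 (length rp))) (+-monoʳ-≤ (length rp) (s≤s z≤n))))

recent-pass : ∀ B pre rp v → All (_∈ pre) v → length pre + length v ≤ B →
              product (wsizes (pre ++ rp) v) ≤ suc B ^ length v
recent-pass B pre rp [] _ _ = ≤-refl
recent-pass B pre rp (x ∷ v) (x∈ ∷ v∈) fits =
  *-mono-≤ head (recent-pass B (x ∷ pre) rp v (All.map there v∈) (≤-trans (≤-reflexive (sym (+-suc (length pre) (length v)))) fits))
  where
  head : distinctCount (x ∷ since x (pre ++ rp)) ≤ suc B
  head = ≤-trans (wsize≤ x (pre ++ rp))
           (s≤s (≤-trans (since-within x pre rp x∈) (≤-trans (m≤m+n _ _) (≤-trans (+-monoʳ-≤ (length pre) (n≤1+n _)) fits))))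

repeat-once : ∀ r rp → product (wsizes (r ʳ++ rp) r) ≤ suc (length r + length r) ^ length r
repeat-once r rp = subst (λ z → product (wsizes z r) ≤ _) (sym (ʳ++-defn r))
  (recent-pass (length r + length r) (r ʳ++ []) rp r
     (All.tabulate (λ z∈ → reverseAcc⁺ [] r (inj₂ z∈)))
     (≤-reflexive (cong (_+ length r) (trans (length-ʳ++ r) (+-identityʳ (length r))))))

repeats : ℕ → List ℕ → List ℕ
repeats R r = concat (replicate R r)

repeat-many : ∀ r R rp → product (wsizes (r ʳ++ rp) (repeats R r)) ≤ suc (length r + length r) ^ (length r * R)
repeat-many r zero rp = ≤-reflexive (cong (suc (length r + length r) ^_) (sym (*-zeroʳ (length r))))
repeat-many r (suc R) rp = begin
  product (wsizes (r ʳ++ rp) (r ++ repeats R r))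
    ≡⟨ cong product (wsizes-++ (r ʳ++ rp) r _) ⟩
  product (wsizes (r ʳ++ rp) r ++ wsizes (r ʳ++ (r ʳ++ rp)) (repeats R r))
    ≡⟨ product-++ (wsizes (r ʳ++ rp) r) _ ⟩
  product (wsizes (r ʳ++ rp) r) * product (wsizes (r ʳ++ (r ʳ++ rp)) (repeats R r))
    ≤⟨ *-mono-≤ (repeat-once r rp) (repeat-many r R (r ʳ++ rp)) ⟩
  B ^ length r * B ^ (length r * R)   ≡⟨ sym (^-distribˡ-+-* B (length r) (length r * R)) ⟩
  B ^ (length r + length r * R)       ≡⟨ cong (B ^_) (sym (*-suc (length r) R)) ⟩
  B ^ (length r * suc R)              ∎
  where
  open ≤-Reasoning
  B : ℕ
  B = suc (length r + length r)

block : ∀ r R rp → product (wsizes rp (repeats (suc R) r)) ≤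
        (length rp + length r) ^ length r * suc (length r + length r) ^ (length r * R)
block r R rp = begin
  product (wsizes rp (r ++ repeats R r))
    ≡⟨ cong product (wsizes-++ rp r _) ⟩
  product (wsizes rp r ++ wsizes (r ʳ++ rp) (repeats R r))
    ≡⟨ product-++ (wsizes rp r) _ ⟩
  product (wsizes rp r) * product (wsizes (r ʳ++ rp) (repeats R r))
    ≤⟨ *-mono-≤ (first-pass rp r) (repeat-many r R rp) ⟩
  (length rp + length r) ^ length r * suc (length r + length r) ^ (length r * R) ∎
  where open ≤-Reasoning

data Blocks (L R : ℕ) : ℕ → List (List ℕ) → Set where
  none : Blocks L R 0 []
  snoc : ∀ {nb rs} r → Blocks L R nb rs → length r ≡ L → Blocks L R (suc nb) (rs ++ replicate R r)

blocks-++ : ∀ {L R nb₁ nb₂ xs ys} → Blocks L R nb₁ xs → Blocks L R nb₂ ys → Blocks L R (nb₂ + nb₁) (xs ++ ys)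
blocks-++ {xs = xs} bx none = subst (Blocks _ _ _) (sym (++-identityʳ xs)) bx
blocks-++ {L} {R} {xs = xs} bx (snoc {rs = rs} r b |r|) =
  subst (Blocks L R _) (++-assoc xs rs (replicate R r)) (snoc r (blocks-++ bx b) |r|)

repeats-length : ∀ (r : List ℕ) R → length (repeats R r) ≡ R * length r
repeats-length r zero = refl
repeats-length r (suc R) = trans (length-++ r) (cong (length r +_) (repeats-length r R))

blocks-ws : ∀ {L R nb rs} → Blocks L (suc R) nb rs → ∀ rp m → length rp + length (concat rs) ≤ m →
            product (wsizes rp (concat rs)) ≤ m ^ (L * nb) * suc (L + L) ^ (L * R * nb)
blocks-ws {L} {R} none rp m _ =
  ≤-reflexive (sym (cong₂ (λ a b → m ^ a * suc (L + L) ^ b) (*-zeroʳ L) (*-zeroʳ (L * R))))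
blocks-ws {L} {R} (snoc {nb} {rs} r b |r|≡L) rp m fits = begin
  product (wsizes rp (concat (rs ++ replicate (suc R) r)))
    ≡⟨ cong (λ z → product (wsizes rp z)) (sym (concat-++ rs (replicate (suc R) r))) ⟩
  product (wsizes rp (concat rs ++ repeats (suc R) r))
    ≡⟨ cong product (wsizes-++ rp (concat rs) _) ⟩
  product (wsizes rp (concat rs) ++ wsizes rp′ (repeats (suc R) r))
    ≡⟨ product-++ (wsizes rp (concat rs)) _ ⟩
  product (wsizes rp (concat rs)) * product (wsizes rp′ (repeats (suc R) r))
    ≤⟨ *-mono-≤ (blocks-ws b rp m earlier-fits) (block r R rp′) ⟩
  (m ^ (L * nb) * B ^ (L * R * nb)) * ((length rp′ + length r) ^ length r * suc (length r + length r) ^ (length r * R))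
    ≡⟨ cong (λ z → (m ^ (L * nb) * B ^ (L * R * nb)) * ((length rp′ + z) ^ z * suc (z + z) ^ (z * R))) |r|≡L ⟩
  (m ^ (L * nb) * B ^ (L * R * nb)) * ((length rp′ + L) ^ L * B ^ (L * R))
    ≤⟨ *-monoʳ-≤ (m ^ (L * nb) * B ^ (L * R * nb)) (*-monoˡ-≤ (B ^ (L * R)) (^-monoˡ-≤ L block-fits)) ⟩
  (m ^ (L * nb) * B ^ (L * R * nb)) * (m ^ L * B ^ (L * R))
    ≡⟨ collect-powers ⟩
  m ^ (L * suc nb) * B ^ (L * R * suc nb) ∎
  where
  open ≤-Reasoning
  B : ℕ
  B = suc (L + L)
  rp′ : List ℕ
  rp′ = concat rs ʳ++ rp
  total : length (concat (rs ++ replicate (suc R) r)) ≡ length (concat rs) + suc R * L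
  total = trans (cong length (sym (concat-++ rs (replicate (suc R) r))))
                (trans (length-++ (concat rs)) (cong (length (concat rs) +_) (trans (repeats-length r (suc R)) (cong (suc R *_) |r|≡L))))
  earlier-fits : length rp + length (concat rs) ≤ m
  earlier-fits = ≤-trans (+-monoʳ-≤ (length rp) (≤-trans (m≤m+n _ (suc R * L)) (≤-reflexive (sym total)))) fits
  block-fits : length rp′ + L ≤ m
  block-fits = begin
    length rp′ + L                          ≡⟨ cong (_+ L) (trans (length-ʳ++ (concat rs)) (+-comm (length (concat rs)) (length rp))) ⟩
    length rp + length (concat rs) + L      ≡⟨ +-assoc (length rp) (length (concat rs)) L ⟩
    length rp + (length (concat rs) + L)    ≤⟨ +-monoʳ-≤ (length rp) (+-monoʳ-≤ (length (concat rs)) (m≤m+n L (R * L))) ⟩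
    length rp + (length (concat rs) + suc R * L) ≡⟨ cong (length rp +_) (sym total) ⟩
    length rp + length (concat (rs ++ replicate (suc R) r)) ≤⟨ fits ⟩
    m ∎
  collect-powers : (m ^ (L * nb) * B ^ (L * R * nb)) * (m ^ L * B ^ (L * R)) ≡ m ^ (L * suc nb) * B ^ (L * R * suc nb)
  collect-powers = begin-equality
    (m ^ (L * nb) * B ^ (L * R * nb)) * (m ^ L * B ^ (L * R))
      ≡⟨ solve 4 (λ a b c e → (a :* b) :* (c :* e) := (a :* c) :* (b :* e)) refl (m ^ (L * nb)) (B ^ (L * R * nb)) (m ^ L) (B ^ (L * R)) ⟩
    (m ^ (L * nb) * m ^ L) * (B ^ (L * R * nb) * B ^ (L * R))
      ≡⟨ cong₂ _*_ (sym (^-distribˡ-+-* m (L * nb) L)) (sym (^-distribˡ-+-* B (L * R * nb) (L * R))) ⟩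
    m ^ (L * nb + L) * B ^ (L * R * nb + L * R)
      ≡⟨ cong₂ (λ a b → m ^ a * B ^ b) (trans (+-comm (L * nb) L) (sym (*-suc L nb))) (trans (+-comm (L * R * nb) (L * R)) (sym (*-suc (L * R) nb))) ⟩
    m ^ (L * suc nb) * B ^ (L * R * suc nb) ∎

sumOver-replicate : {A : Set} (c : A → ℕ) → ∀ R r → sumOver c (replicate R r) ≡ R * c r
sumOver-replicate c zero r = refl
sumOver-replicate c (suc R) r = cong (c r +_) (sumOver-replicate c R r)

module HardSequence (k h R : ℕ) where
  L : ℕ
  L = 2 * k
  A : ℕ
  A = L * h
  M : ℕ
  M = A + A

  gapRounds : ℕ → ℕ → List (List ℕ)
  gapRounds g zero = []
  gapRounds g (suc s) = gapRounds g s ++ replicate R (round L g s)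

  allRounds : ℕ → List (List ℕ)
  allRounds zero = []
  allRounds (suc g) = allRounds g ++ gapRounds g A

  sequence : List ℕ
  sequence = concat (allRounds h)

  gapRounds-blocks : ∀ g s → Blocks L R s (gapRounds g s)
  gapRounds-blocks g zero = none
  gapRounds-blocks g (suc s) = snoc (round L g s) (gapRounds-blocks g s) (progression-length _ 0 L)

  allRounds-blocks : ∀ g → Blocks L R (g * A) (allRounds g)
  allRounds-blocks zero = none
  allRounds-blocks (suc g) = blocks-++ (allRounds-blocks g) (gapRounds-blocks g A)

  allRounds-all : ∀ (P : List ℕ → Set) → (∀ g s → g < h → s < A → P (round L g s)) → ∀ g → g ≤ h → All P (allRounds g)
  allRounds-all P p zero _ = []
  allRounds-all P p (suc g) g<h = All.++⁺ (allRounds-all P p g (<⇒≤ g<h)) (gap A ≤-refl)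
    where
    gap : ∀ s → s ≤ A → All P (gapRounds g s)
    gap zero _ = []
    gap (suc s) s<A = All.++⁺ (gap s (<⇒≤ s<A)) (All.replicate⁺ R (p g s g<h s<A))

  gapRounds-length : ∀ g s → length (gapRounds g s) ≡ s * R
  gapRounds-length g zero = refl
  gapRounds-length g (suc s) =
    trans (length-++ (gapRounds g s)) (trans (cong₂ _+_ (gapRounds-length g s) (length-replicate R)) (+-comm (s * R) R))

  allRounds-length : ∀ g → length (allRounds g) ≡ g * (A * R)
  allRounds-length zero = refl
  allRounds-length (suc g) =
    trans (length-++ (allRounds g)) (trans (cong₂ _+_ (allRounds-length g) (gapRounds-length g A)) (+-comm (g * (A * R)) (A * R)))

  gapRounds-sum : ∀ c g s → sumOver c (gapRounds g s) ≡ R * sumN s (λ s′ → c (round L g s′))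
  gapRounds-sum c g zero = sym (*-zeroʳ R)
  gapRounds-sum c g (suc s) =
    trans (sumOver-++ c (gapRounds g s) _)
          (trans (cong₂ _+_ (gapRounds-sum c g s) (sumOver-replicate c R (round L g s))) (sym (*-distribˡ-+ R _ _)))

  allRounds-sum : ∀ c g → sumOver c (allRounds g) ≡ R * sumN g (λ g′ → sumN A (λ s′ → c (round L g′ s′)))
  allRounds-sum c zero = sym (*-zeroʳ R)
  allRounds-sum c (suc g) =
    trans (sumOver-++ c (allRounds g) _)
          (trans (cong₂ _+_ (allRounds-sum c g) (gapRounds-sum c g A)) (sym (*-distribˡ-+ R _ _)))

  term-fits : 1 ≤ h → ∀ i g → i < L → g < h → suc (i * suc g) + A ≤ M
  term-fits h≥1 i g i<L g<h = +-monoˡ-≤ A (begin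
    suc (i * suc g)  ≤⟨ s≤s (*-monoʳ-≤ i g<h) ⟩
    suc (i * h)      ≡⟨ +-comm 1 (i * h) ⟩
    i * h + 1        ≤⟨ +-monoʳ-≤ (i * h) h≥1 ⟩
    i * h + h        ≡⟨ +-comm (i * h) h ⟩
    suc i * h        ≤⟨ *-monoˡ-≤ h i<L ⟩
    L * h            ∎)
    where open ≤-Reasoning

  term-range : 1 ≤ h → ∀ g s j → g < h → s < A → j < L → InRange M (term g s j)
  term-range h≥1 g s j g<h s<A j<L = s≤s z≤n , (begin
    suc s + j * suc g        ≤⟨ +-monoˡ-≤ (j * suc g) s<A ⟩
    A + j * suc g            ≤⟨ +-monoʳ-≤ A (n≤1+n _) ⟩
    A + suc (j * suc g)      ≡⟨ +-comm A _ ⟩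
    suc (j * suc g) + A      ≤⟨ term-fits h≥1 j g j<L g<h ⟩
    M                        ∎)
    where open ≤-Reasoning

div-upper : ∀ n b .{{_ : NonZero b}} → n < suc (n / b) * b
div-upper n b = begin-strict
  n                    ≡⟨ m≡m%n+[m/n]*n n b ⟩
  n % b + (n / b) * b  <⟨ +-monoˡ-< ((n / b) * b) (m%n<n n b) ⟩
  suc (n / b) * b      ∎
  where open ≤-Reasoning

div-lower : ∀ a b n .{{_ : NonZero b}} → a * b ≤ n → a ≤ n / b
div-lower a b n ab≤n = subst (_≤ n / b) (m*n/n≡m a b) (/-monoˡ-≤ b ab≤n)

dyadic : ∀ q → 1 ≤ q → ∃[ d ] (2 ^ d ≤ q × q < 2 ^ suc d)
dyadic (suc zero) _ = 0 , s≤s z≤n , s≤s (s≤s z≤n)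
dyadic (suc (suc q)) _ with dyadic (suc q) (s≤s z≤n)
... | d , lo , hi with suc (suc q) <? 2 ^ suc d
... | yes below = d , ≤-trans lo (n≤1+n _) , below
... | no ¬below = suc d , ≤-reflexive power , subst (_< 2 ^ suc (suc d)) power (^-monoʳ-< 2 (s≤s (s≤s z≤n)) (n<1+n (suc d)))
  where
  power : 2 ^ suc d ≡ suc (suc q)
  power = ≤-antisym (≮⇒≥ ¬below) hi

n<2^n : ∀ x → x < 2 ^ x
n<2^n zero = ≤-refl
n<2^n (suc x) = begin-strict
  suc x          <⟨ s≤s (n<2^n x) ⟩
  suc (2 ^ x)    ≤⟨ +-monoˡ-≤ (2 ^ x) (m^n>0 2 x) ⟩
  2 ^ x + 2 ^ x  ≡⟨ cong (2 ^ x +_) (sym (+-identityʳ (2 ^ x))) ⟩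
  2 ^ suc x      ∎
  where open ≤-Reasoning

repetitions-dominate : ∀ P → suc (4 * P) * P ≤ 2 ^ suc (4 * P)
repetitions-dominate zero = z≤n
repetitions-dominate (suc P) = begin
  suc (4 * suc P) * suc P         ≡⟨ solve 1 (λ P → (con 1 :+ con 4 :* (con 1 :+ P)) :* (con 1 :+ P)
                                                    := (con 1 :+ con 4 :* P) :* P :+ (con 8 :* P :+ con 5)) refl P ⟩
  suc (4 * P) * P + (8 * P + 5)   ≤⟨ +-mono-≤ (repetitions-dominate P) increment ⟩
  G + 15 * G                      ≡⟨ solve 1 (λ G → G :+ con 15 :* G := con 16 :* G) refl G ⟩
  16 * G                          ≡⟨ sym (^-distribˡ-+-* 2 4 (suc (4 * P))) ⟩
  2 ^ (4 + suc (4 * P))           ≡⟨ cong (λ z → 2 ^ suc z) (sym (*-suc 4 P)) ⟩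
  2 ^ suc (4 * suc P)             ∎
  where
  open ≤-Reasoning
  G : ℕ
  G = 2 ^ suc (4 * P)
  increment : 8 * P + 5 ≤ 15 * G
  increment = begin
    8 * P + 5              ≤⟨ m≤m+n (8 * P + 5) (52 * P + 25) ⟩
    8 * P + 5 + (52 * P + 25) ≡⟨ solve 1 (λ P → (con 8 :* P :+ con 5) :+ (con 52 :* P :+ con 25) := con 15 :* (con 2 :+ con 4 :* P)) refl P ⟩
    15 * suc (suc (4 * P)) ≤⟨ *-monoʳ-≤ 15 (n<2^n (suc (4 * P))) ⟩
    15 * G                 ∎

-- the working sets of repeated rounds of 2k requests have size ≤ 4k + 1 ≤ k^4
repeat-window≤k⁴ : ∀ k → 2 ≤ k → suc (2 * k + 2 * k) ≤ k ^ 4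
repeat-window≤k⁴ k 2≤k = begin
  suc (2 * k + 2 * k)              ≡⟨ +-comm 1 (2 * k + 2 * k) ⟩
  2 * k + 2 * k + 1                ≤⟨ +-monoʳ-≤ (2 * k + 2 * k) (≤-trans (s≤s z≤n) 2≤k) ⟩
  2 * k + 2 * k + k                ≤⟨ m≤m+n _ (3 * k) ⟩
  2 * k + 2 * k + k + 3 * k        ≡⟨ solve 1 (λ k → con 2 :* k :+ con 2 :* k :+ k :+ con 3 :* k := con 2 :* (con 2 :* (con 2 :* k))) refl k ⟩
  2 * (2 * (2 * k))                ≤⟨ *-mono-≤ 2≤k (*-mono-≤ 2≤k (*-monoˡ-≤ k 2≤k)) ⟩
  k * (k * (k * k))                ≡⟨ cong (λ z → k * (k * (k * z))) (sym (*-identityʳ k)) ⟩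
  k ^ 4                            ∎
  where open ≤-Reasoning

^-distribʳ-* : ∀ a b e → (a * b) ^ e ≡ a ^ e * b ^ e
^-distribʳ-* a b zero = refl
^-distribʳ-* a b (suc e) =
  trans (cong (a * b *_) (^-distribʳ-* a b e))
        (solve 4 (λ a b x y → a :* b :* (x :* y) := a :* x :* (b :* y)) refl a b (a ^ e) (b ^ e))

^-double : ∀ a e → a ^ (2 * e) ≡ (a * a) ^ e
^-double a e = trans (sym (^-*-assoc a 2 e)) (cong (λ z → (a * z) ^ e) (*-identityʳ a))

^-cancelʳ-≤ : ∀ a b e → 0 < e → a ^ e ≤ b ^ e → a ≤ b
^-cancelʳ-≤ a b e e>0 aᵉ≤bᵉ with a ≤? b
... | yes a≤b = a≤b
... | no a≰b = contradiction aᵉ≤bᵉ (<⇒≱ (^-monoˡ-< e {{>-nonZero e>0}} (≰⇒> a≰b)))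

module HardSequenceBounds (k h R′ : ℕ) where
  R : ℕ
  R = suc R′
  open HardSequence k h R

  few-close-pairs : ∀ T n d → IsBSTOn n T → 1 ≤ h → 2 ^ d * (64 * k) ≤ h →
                    2 * sumOver (Closeness.closePairs T n d []) (allRounds h) ≤ k * length (allRounds h)
  few-close-pairs T n d bst h≥1 scale = begin
    2 * sumOver (closePairs []) (allRounds h)
      ≡⟨ cong (2 *_) (allRounds-sum (closePairs []) h) ⟩
    2 * (R * total)
      ≡⟨ solve 2 (λ R t → con 2 :* (R :* t) := R :* (con 2 :* t)) refl R total ⟩
    R * (2 * total)
      ≤⟨ *-monoʳ-≤ R (*-monoʳ-≤ 2 (all-rounds L (term-fits h≥1))) ⟩
    R * (2 * (L * (L * (M * 2 ^ (d + 2)))))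
      ≡⟨ cong (λ z → R * (2 * (L * (L * (M * z))))) (^-distribˡ-+-* 2 d 2) ⟩
    R * (2 * (L * (L * (M * (2 ^ d * 4)))))
      ≡⟨ solve 4 (λ R k h t → R :* (con 2 :* ((con 2 :* k) :* ((con 2 :* k) :* (((con 2 :* k) :* h :+ (con 2 :* k) :* h) :* (t :* con 4)))))
                           := R :* (con 2 :* k :* k :* h) :* (t :* (con 64 :* k))) refl R k h (2 ^ d) ⟩
    R * (2 * k * k * h) * (2 ^ d * (64 * k))
      ≤⟨ *-monoʳ-≤ (R * (2 * k * k * h)) scale ⟩
    R * (2 * k * k * h) * h
      ≡⟨ solve 3 (λ R k h → R :* (con 2 :* k :* k :* h) :* h := k :* (h :* ((con 2 :* k) :* h :* R))) refl R k h ⟩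
    k * (h * (A * R))
      ≡⟨ cong (k *_) (sym (allRounds-length h)) ⟩
    k * length (allRounds h) ∎
    where
    open ≤-Reasoning
    open Closeness T n d
    open CloseRounds T n d bst h A M
    total = sumN h (λ g → sumN A (λ s → closePairs [] (round L g s)))

  sequence-length : length sequence ≡ R * (L * (h * A))
  sequence-length = begin-equality
    length sequence                ≡⟨ length-concat L (allRounds h) (allRounds-all _ (λ g s _ _ → progression-length (term g s) 0 L) h ≤-refl) ⟩
    L * length (allRounds h)       ≡⟨ cong (L *_) (allRounds-length h) ⟩
    L * (h * (A * R))              ≡⟨ solve 4 (λ L h A R → L :* (h :* (A :* R)) := R :* (L :* (h :* A))) refl L h A R ⟩
    R * (L * (h * A))              ∎
    where open ≤-Reasoning

  working-set : 2 ≤ k → R′ ≡ 4 * (L * (h * A)) → expWS sequence ≤ k ^ (5 * length sequence)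
  working-set 2≤k R′≡ = begin
    product (wsizes [] sequence)
      ≤⟨ blocks-ws (allRounds-blocks h) [] m ≤-refl ⟩
    m ^ (L * (h * A)) * suc (L + L) ^ (L * R′ * (h * A))
      ≤⟨ *-mono-≤ (^-monoˡ-≤ (L * (h * A)) m≤kᴿ) (^-monoˡ-≤ (L * R′ * (h * A)) (repeat-window≤k⁴ k 2≤k)) ⟩
    (k ^ R) ^ P * (k ^ 4) ^ (L * R′ * (h * A))
      ≡⟨ cong₂ _*_ (^-*-assoc k R P) (^-*-assoc k 4 (L * R′ * (h * A))) ⟩
    k ^ (R * P) * k ^ (4 * (L * R′ * (h * A)))
      ≤⟨ *-monoʳ-≤ (k ^ (R * P)) (^-monoʳ-≤ k {{>-nonZero (≤-trans (s≤s z≤n) 2≤k)}} (*-monoʳ-≤ 4 repeats≤m)) ⟩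
    k ^ (R * P) * k ^ (4 * (R * P))
      ≡⟨ sym (^-distribˡ-+-* k (R * P) (4 * (R * P))) ⟩
    k ^ (R * P + 4 * (R * P))
      ≡⟨ cong (k ^_) (solve 1 (λ x → x :+ con 4 :* x := con 5 :* x) refl (R * P)) ⟩
    k ^ (5 * (R * P))
      ≡⟨ cong (λ z → k ^ (5 * z)) (sym sequence-length) ⟩
    k ^ (5 * length sequence) ∎
    where
    open ≤-Reasoning
    P : ℕ
    P = L * (h * A)
    m : ℕ
    m = length sequence
    m≤kᴿ : m ≤ k ^ R
    m≤kᴿ = begin
      m                 ≡⟨ sequence-length ⟩
      R * P             ≡⟨ cong (λ z → suc z * P) R′≡ ⟩
      suc (4 * P) * P   ≤⟨ repetitions-dominate P ⟩
      2 ^ suc (4 * P)   ≡⟨ cong (λ z → 2 ^ suc z) (sym R′≡) ⟩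
      2 ^ R             ≤⟨ ^-monoˡ-≤ R 2≤k ⟩
      k ^ R             ∎
    repeats≤m : L * R′ * (h * A) ≤ R * P
    repeats≤m = ≤-trans (≤-reflexive (solve 4 (λ L R′ h A → L :* R′ :* (h :* A) := R′ :* (L :* (h :* A))) refl L R′ h A))
                        (*-monoˡ-≤ P (n≤1+n R′))

record HardInstance (n k : ℕ) : Set where
  field
    S : List ℕ
    nonempty : 1 ≤ length S
    in-range : All (InRange n) S
    working-set-bound : expWS S ≤ k ^ (5 * length S)
    d : ℕ
    scale : n ≤ 2 ^ suc d * (256 * (k * k))
    finger-cost : ∀ T → IsBSTOn n T → (ℓ : Vec ℕ k) → (fs : List (Fin k)) →
                  length fs ≡ length S → suc d * length S ≤ 4 * fingerCost T ℓ S fs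

-- Parameters: h = ⌊n/4k⌋ gaps, so the terms fit in [n]; scale d with 2^d ≤ h/64k < 2^(d+1);
-- each round repeated R = 4P + 1 times, P the length of the first passes.
hard-instance : ∀ n k → 2 ≤ k → 256 * (k * k) ≤ n → HardInstance n k
hard-instance n (suc zero) (s≤s ()) _
hard-instance n k@(suc (suc _)) 2≤k big = record
  { S = sequence
  ; nonempty = subst (1 ≤_) (sym sequence-length) (*-mono-≤ {1} {R} (s≤s z≤n) P≥1)
  ; in-range = All.concat⁺ (All.map proj₂ rounds)
  ; working-set-bound = working-set 2≤k refl
  ; d = d
  ; scale = scale
  ; finger-cost = λ T bst ℓ fs |fs| →
      SequenceCharge.sequence-lower T n d k (allRounds h) ℓ fs rounds |fs| (few-close-pairs T n d bst h≥1 2ᵈ64k≤h)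
  }
  where
  h : ℕ
  h = n / (4 * k)
  P : ℕ
  P = 2 * k * (h * (2 * k * h))
  open HardSequenceBounds k h (4 * P)
  open HardSequence k h R
  64k≤h : 64 * k ≤ h
  64k≤h = div-lower (64 * k) (4 * k) n (≤-trans (≤-reflexive (solve 1 (λ k → (con 64 :* k) :* (con 4 :* k) := con 256 :* (k :* k)) refl k)) big)
  h≥1 : 1 ≤ h
  h≥1 = ≤-trans (s≤s z≤n) 64k≤h
  P≥1 : 1 ≤ P
  P≥1 = *-mono-≤ {1} {L} (s≤s z≤n) (*-mono-≤ {1} {h} h≥1 (*-mono-≤ {1} {L} (s≤s z≤n) h≥1))
  dyadic-scale : ∃[ d ] (2 ^ d ≤ h / (64 * k) × h / (64 * k) < 2 ^ suc d)
  dyadic-scale = dyadic (h / (64 * k)) (div-lower 1 (64 * k) h (≤-trans (≤-reflexive (*-identityˡ (64 * k))) 64k≤h))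
  d : ℕ
  d = proj₁ dyadic-scale
  2ᵈ64k≤h : 2 ^ d * (64 * k) ≤ h
  2ᵈ64k≤h = ≤-trans (*-monoˡ-≤ (64 * k) (proj₁ (proj₂ dyadic-scale))) (m/n*n≤m h (64 * k))
  scale : n ≤ 2 ^ suc d * (256 * (k * k))
  scale = begin
    n                            ≤⟨ <⇒≤ (div-upper n (4 * k)) ⟩
    suc h * (4 * k)              ≤⟨ *-monoˡ-≤ (4 * k) (≤-trans (div-upper h (64 * k)) (*-monoˡ-≤ (64 * k) (proj₂ (proj₂ dyadic-scale)))) ⟩
    2 ^ suc d * (64 * k) * (4 * k) ≡⟨ solve 2 (λ t k → t :* (con 64 :* k) :* (con 4 :* k) := t :* (con 256 :* (k :* k))) refl (2 ^ suc d) k ⟩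
    2 ^ suc d * (256 * (k * k))  ∎
    where open ≤-Reasoning
  M≤n : M ≤ n
  M≤n = ≤-trans (≤-reflexive (solve 2 (λ k h → (con 2 :* k :* h) :+ (con 2 :* k :* h) := h :* (con 4 :* k)) refl k h)) (m/n*n≤m n (4 * k))
  rounds : All (IsRound n k) (allRounds h)
  rounds = allRounds-all _ (λ g s g<h s<A → progression-length (term g s) 0 L ,
             progression-all _ (term g s) 0 L (λ j j<L → let (1≤t , t≤M) = term-range h≥1 g s j g<h s<A j<L in 1≤t , ≤-trans t≤M M≤n)) h ≤-refl

threshold : ℕ → ℕ → ℕ
threshold εd Cn = (256 * (Cn * Cn)) ^ εd

-- The hypothesis k ≤ (Cn/Cd)·n^(1/2 − ε), ε = εn/εd, raised to the power 2εd, and its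
-- consequences above the threshold N = (256 Cn²)^εd: n ≥ 256k², and a scale d with
-- n ≤ 2^(d+1)·256k² satisfies n^εn ≤ 2^((d+1)εd), i.e. (d+1) ≥ ε log n ≥ ε log(n/k).

module Regime (εn εd Cn n k : ℕ) where
  E : ℕ
  E = n ^ εn
  K : ℕ
  K = (k * k) ^ εd

  without-Cd : ∀ Cd → 0 < Cd → (Cd * k) ^ (2 * εd) * n ^ (2 * εn) ≤ Cn ^ (2 * εd) * n ^ εd →
               K * (E * E) ≤ (Cn * Cn) ^ εd * n ^ εd
  without-Cd Cd Cd>0 hyp = begin
    K * (E * E)                          ≤⟨ *-monoˡ-≤ (E * E) (m≤n*m K (Cd ^ (2 * εd)) {{>-nonZero (m^n>0 Cd {{>-nonZero Cd>0}} (2 * εd))}}) ⟩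
    Cd ^ (2 * εd) * K * (E * E)          ≡⟨ cong₂ _*_ (trans (cong (Cd ^ (2 * εd) *_) (sym (^-double k εd))) (sym (^-distribʳ-* Cd k (2 * εd))))
                                                      (sym (trans (^-distribˡ-+-* n εn (εn + 0)) (cong (E *_) (cong (n ^_) (+-identityʳ εn))))) ⟩
    (Cd * k) ^ (2 * εd) * n ^ (2 * εn)   ≤⟨ hyp ⟩
    Cn ^ (2 * εd) * n ^ εd               ≡⟨ cong (_* n ^ εd) (^-double Cn εd) ⟩
    (Cn * Cn) ^ εd * n ^ εd              ∎
    where open ≤-Reasoning

  above : 0 < εn → 1 ≤ n → threshold εd Cn ≤ n → threshold εd Cn ≤ E
  above εn>0 n≥1 N≤n = ≤-trans N≤n (≤-trans (≤-reflexive (sym (*-identityʳ n))) (^-monoʳ-≤ n {{>-nonZero n≥1}} εn>0))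

  large : 0 < εn → 0 < εd → 1 ≤ n → threshold εd Cn ≤ n → K * (E * E) ≤ (Cn * Cn) ^ εd * n ^ εd → 256 * (k * k) ≤ n
  large εn>0 εd>0 n≥1 N≤n hyp′ = ^-cancelʳ-≤ (256 * (k * k)) n εd εd>0
    (*-cancelʳ-≤ ((256 * (k * k)) ^ εd) (n ^ εd) (E * E) {{E²≢0}} (begin
      (256 * (k * k)) ^ εd * (E * E)           ≡⟨ cong (_* (E * E)) (^-distribʳ-* 256 (k * k) εd) ⟩
      256 ^ εd * K * (E * E)                   ≡⟨ *-assoc (256 ^ εd) K (E * E) ⟩
      256 ^ εd * (K * (E * E))                 ≤⟨ *-monoʳ-≤ (256 ^ εd) hyp′ ⟩
      256 ^ εd * ((Cn * Cn) ^ εd * n ^ εd)     ≡⟨ sym (*-assoc (256 ^ εd) _ _) ⟩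
      256 ^ εd * (Cn * Cn) ^ εd * n ^ εd       ≡⟨ cong (_* n ^ εd) (sym (^-distribʳ-* 256 (Cn * Cn) εd)) ⟩
      threshold εd Cn * n ^ εd                       ≤⟨ *-monoˡ-≤ (n ^ εd) (≤-trans (above εn>0 n≥1 N≤n) (m≤m*n E E {{E≢0}})) ⟩
      E * E * n ^ εd                           ≡⟨ *-comm (E * E) (n ^ εd) ⟩
      n ^ εd * (E * E)                         ∎))
    where
    open ≤-Reasoning
    E≢0 : NonZero E
    E≢0 = m^n≢0 n εn {{>-nonZero n≥1}}
    E²≢0 : NonZero (E * E)
    E²≢0 = m*n≢0 E E {{E≢0}} {{E≢0}}

  gain : ∀ d → 0 < εn → 1 ≤ n → 1 ≤ k → threshold εd Cn ≤ n → K * (E * E) ≤ (Cn * Cn) ^ εd * n ^ εd →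
         n ≤ 2 ^ suc d * (256 * (k * k)) → E ≤ (2 ^ suc d) ^ εd
  gain d εn>0 n≥1 k≥1 N≤n hyp′ scale =
    *-cancelˡ-≤ E {{E≢0}} (*-cancelʳ-≤ (E * E) (E * X) K {{m^n≢0 (k * k) εd {{m*n≢0 k k {{k≢0}} {{k≢0}}}}}} (begin
      E * E * K                                         ≡⟨ *-comm (E * E) K ⟩
      K * (E * E)                                       ≤⟨ hyp′ ⟩
      (Cn * Cn) ^ εd * n ^ εd                           ≤⟨ *-monoʳ-≤ ((Cn * Cn) ^ εd) (^-monoˡ-≤ εd scale) ⟩
      (Cn * Cn) ^ εd * (2 ^ suc d * (256 * (k * k))) ^ εd
        ≡⟨ cong ((Cn * Cn) ^ εd *_) (trans (^-distribʳ-* (2 ^ suc d) (256 * (k * k)) εd) (cong (X *_) (^-distribʳ-* 256 (k * k) εd))) ⟩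
      (Cn * Cn) ^ εd * (X * (256 ^ εd * K))
        ≡⟨ solve 4 (λ c x t kk → c :* (x :* (t :* kk)) := (t :* c) :* x :* kk) refl ((Cn * Cn) ^ εd) X (256 ^ εd) K ⟩
      256 ^ εd * (Cn * Cn) ^ εd * X * K                 ≡⟨ cong (λ z → z * X * K) (sym (^-distribʳ-* 256 (Cn * Cn) εd)) ⟩
      threshold εd Cn * X * K                                 ≤⟨ *-monoˡ-≤ K (*-monoˡ-≤ X (above εn>0 n≥1 N≤n)) ⟩
      E * X * K                                         ∎))
    where
    open ≤-Reasoning
    X : ℕ
    X = (2 ^ suc d) ^ εd
    E≢0 : NonZero E
    E≢0 = m^n≢0 n εn {{>-nonZero n≥1}}
    k≢0 : NonZero k
    k≢0 = >-nonZero k≥1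

  -- a cost of (d+1)m/4 with n^εn ≤ 2^((d+1)εd) is the exponentiated bound with c₂ = εn/4εd
  exponentiated : ∀ d m cost → 1 ≤ k → E ≤ (2 ^ suc d) ^ εd → suc d * m ≤ 4 * cost →
                  n ^ (εn * m) ≤ 2 ^ (4 * εd * cost) * k ^ (εn * m)
  exponentiated d m cost k≥1 gained charged = begin
    n ^ (εn * m)                    ≡⟨ sym (^-*-assoc n εn m) ⟩
    E ^ m                           ≤⟨ ^-monoˡ-≤ m gained ⟩
    ((2 ^ suc d) ^ εd) ^ m          ≡⟨ trans (^-*-assoc (2 ^ suc d) εd m) (^-*-assoc 2 (suc d) (εd * m)) ⟩
    2 ^ (suc d * (εd * m))          ≤⟨ ^-monoʳ-≤ 2 exponent ⟩
    2 ^ (4 * εd * cost)             ≤⟨ m≤m*n (2 ^ (4 * εd * cost)) (k ^ (εn * m)) {{m^n≢0 k (εn * m) {{>-nonZero k≥1}}}} ⟩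
    2 ^ (4 * εd * cost) * k ^ (εn * m) ∎
    where
    open ≤-Reasoning
    exponent : suc d * (εd * m) ≤ 4 * εd * cost
    exponent = begin
      suc d * (εd * m)   ≡⟨ solve 3 (λ a b c → a :* (b :* c) := b :* (a :* c)) refl (suc d) εd m ⟩
      εd * (suc d * m)   ≤⟨ *-monoʳ-≤ εd charged ⟩
      εd * (4 * cost)    ≡⟨ solve 2 (λ a c → a :* (con 4 :* c) := con 4 :* a :* c) refl εd cost ⟩
      4 * εd * cost      ∎

mainTheorem14 :
  (εn εd Cn Cd : ℕ) → 0 < εn → 0 < εd → 0 < Cn → 0 < Cd →
  ∃[ c1n ] ∃[ c1d ] ∃[ c2n ] ∃[ c2d ]
    (0 < c1n × 0 < c1d × 0 < c2n × 0 < c2d ×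
     ∃[ N ] ((n : ℕ) → N ≤ n → (k : ℕ) → 2 ≤ k →
       (Cd * k) ^ (2 * εd) * n ^ (2 * εn) ≤ Cn ^ (2 * εd) * n ^ εd →
       ∃[ S ] (1 ≤ length S × All (InRange n) S ×
         expWS S ^ c1d ≤ k ^ (c1n * length S) ×
         LFLowerBound n k S c2n c2d)))
mainTheorem14 εn εd Cn Cd εn>0 εd>0 Cn>0 Cd>0 =
  5 , 1 , εn , 4 * εd , s≤s z≤n , s≤s z≤n , εn>0 , *-mono-≤ {1} {4} (s≤s z≤n) εd>0 , N , hard
  where
  N : ℕ
  N = threshold εd Cn
  N≥1 : 1 ≤ N
  N≥1 = m^n>0 (256 * (Cn * Cn)) {{>-nonZero (*-mono-≤ {1} {256} (s≤s z≤n) (*-mono-≤ Cn>0 Cn>0))}} εd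
  hard : (n : ℕ) → N ≤ n → (k : ℕ) → 2 ≤ k → (Cd * k) ^ (2 * εd) * n ^ (2 * εn) ≤ Cn ^ (2 * εd) * n ^ εd →
         ∃[ S ] (1 ≤ length S × All (InRange n) S × expWS S ^ 1 ≤ k ^ (5 * length S) × LFLowerBound n k S εn (4 * εd))
  hard n N≤n k 2≤k hyp = S , nonempty , in-range , ≤-trans (≤-reflexive (*-identityʳ _)) working-set-bound , lf-bound
    where
    open Regime εn εd Cn n k
    n≥1 : 1 ≤ n
    n≥1 = ≤-trans N≥1 N≤n
    k≥1 : 1 ≤ k
    k≥1 = ≤-trans (s≤s z≤n) 2≤k
    hyp′ : K * (E * E) ≤ (Cn * Cn) ^ εd * n ^ εd
    hyp′ = without-Cd Cd Cd>0 hyp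
    open HardInstance (hard-instance n k 2≤k (large εn>0 εd>0 n≥1 N≤n hyp′))
    lf-bound : LFLowerBound n k S εn (4 * εd)
    lf-bound T bst ℓ _ fs |fs| =
      exponentiated d (length S) (fingerCost T ℓ S fs) k≥1 (gain d εn>0 n≥1 k≥1 N≤n hyp′ scale) (finger-cost T bst ℓ fs |fs|)
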